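{- Let $d \ge 1$ and $M \ge 1$ be integers and let $c = M(d+1)+1$. Then, as formal power series in $a,b$, \[ \sigma_{d,M}(a,b) \,=\, \frac{\prod_{n=1}^M E_d\!\left(a^{(n-1)d} b^n, a\right)}{\left(1 - a^{Md} b^{M+1}\right) \prod_{n=1}^M \prod_{j=0}^d \left(1 - a^{nd-j} b^n\right)} . \]
   Context: A $d$-fold partition diamond of length $M$ is a tuple $(a_1, a_2, \dots, a_c)$ of nonnegative integers, $c = M(d+1)+1$, satisfying, for each $n = 0, 1, \dots, M-1$ and each $i = 1, \dots, d$, \[ a_{n(d+1)+1} \,\ge\, a_{n(d+1)+1+i} \,\ge\, a_{(n+1)(d+1)+1}. \] The entries $a_j$ with $j \equiv 1 \pmod{d+1}$ are called links, and the other entries (those with $j \not\equiv 1 \pmod{d+1}$) are called folds. Define \[ \sigma_{d,M}(a,b) \,:=\, \sum a^{\sum_{j \not\equiv 1 \ (\mathrm{mod}\ d+1)} a_j}\; b^{\sum_{j \equiv 1 \ (\mathrm{mod}\ d+1)} a_j}, \] the sum running over all $d$-fold partition diamonds $(a_1,\dots,a_c)$ of length $M$ (indices $j$ range over $1,\dots,c$). For a permutation $\tau \in S_d$, let $\operatorname{Des}(\tau) := \{ j \in \{1,\dots,d-1\} : \tau(j) > \tau(j+1)\}$, $\operatorname{des}(\tau) := |\operatorname{Des}(\tau)|$, $\operatorname{maj}(\tau) := \sum_{j \in \operatorname{Des}(\tau)} j$, and let $E_d(x,y) := \sum_{\tau \in S_d} x^{\operatorname{des}(\tau)} y^{\operatorname{maj}(\tau)}$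 be the Euler--Mahonian polynomial. -}

module Defs where

open import Data.Nat using (ℕ; zero; suc; _+_; _*_; _∸_; _^_; _≤ᵇ_; _<ᵇ_; _≡ᵇ_)
open import Data.Nat.DivMod using (_%_)
open import Data.Bool using (Bool; true; false; _∧_; not)
open import Data.List using (List; []; _∷_; map; concatMap; length; foldr; upTo; filterᵇ)
open import Data.Nat.ListAction using (sum)

-- at l j = the j-th entry of l (1-based); 0 outside the range (never used there)
at : List ℕ → ℕ → ℕ
at []       _             = 0
at (x ∷ xs) zero          = 0
at (x ∷ xs) (suc zero)    = x
at (x ∷ xs) (suc (suc j)) = at xs (suc j)

oneTo : ℕ → List ℕ
oneTo n = map suc (upTo n)

allLists : ℕ → List ℕ → List (List ℕ)
allLists zero    vals = [] ∷ []
allLists (suc k) vals = concatMap (λ x → map (x ∷_) (allLists k vals)) vals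

allB : {A : Set} → (A → Bool) → List A → Bool
allB p []       = true
allB p (x ∷ xs) = p x ∧ allB p xs

count : {A : Set} → (A → Bool) → List A → ℕ
count p xs = length (filterᵇ p xs)

len : ℕ → ℕ → ℕ
len d M = M * suc d + 1

isDiamond : ℕ → ℕ → List ℕ → Bool
isDiamond d M a =
  (length a ≡ᵇ len d M) ∧
  allB (λ n → allB (λ i →
        (at a (n * suc d + 1 + i) ≤ᵇ at a (n * suc d + 1)) ∧
        (at a (suc n * suc d + 1) ≤ᵇ at a (n * suc d + 1 + i)))
      (oneTo d))
      (upTo M)

isLink : ℕ → ℕ → Bool
isLink d j = j % suc d ≡ᵇ 1 % suc d

linkSum : ℕ → List ℕ → ℕ
linkSum d a = sum (map (at a) (filterᵇ (isLink d) (oneTo (length a))))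

foldSum : ℕ → List ℕ → ℕ
foldSum d a = sum (map (at a) (filterᵇ (λ j → not (isLink d j)) (oneTo (length a))))

-- Formal power series in a, b with ℕ coefficients:
-- s p q = coefficient of a^p b^q

Series : Set
Series = ℕ → ℕ → ℕ

mono : ℕ → ℕ → Series
mono i j p q with i ≡ᵇ p | j ≡ᵇ q
... | true | true = 1
... | _    | _    = 0

one : Series
one = mono 0 0

_⊕_ : Series → Series → Series
(f ⊕ g) p q = f p q + g p q

zeroS : Series
zeroS _ _ = 0

_⊗_ : Series → Series → Series
(f ⊗ g) p q = sum (map (λ i → sum (map (λ j → f i j * g (p ∸ i) (q ∸ j)) (upTo (suc q)))) (upTo (suc p)))

infixl 6 _⊕_
infixl 7 _⊗_

prodS : List ℕ → (ℕ → Series) → Series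
prodS xs F = foldr (λ x acc → F x ⊗ acc) one xs

-- The inverse 1 / (1 - a^i b^j) = Σ_{k ≥ 0} a^{ik} b^{jk}, for (i,j) ≠ (0,0)
-- (then the coefficient of a^p b^q is 1 iff p = ik, q = jk for some k, and k ≤ p + q).
inv1m : ℕ → ℕ → Series
inv1m i j p q = count (λ k → (k * i ≡ᵇ p) ∧ (k * j ≡ᵇ q)) (upTo (suc (p + q)))

-- σ_{d,M}(a,b): coefficient of a^p b^q is the number of d-fold partition
-- diamonds of length M with fold sum p and link sum q.  Every entry of such
-- a diamond is ≤ p + q, so enumerating tuples with entries in [0 .. p+q]
-- is exhaustive.

sigma : ℕ → ℕ → Series
sigma d M p q =
  count (λ a → isDiamond d M a ∧ (foldSum d a ≡ᵇ p) ∧ (linkSum d a ≡ᵇ q))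
        (allLists (len d M) (upTo (suc (p + q))))

perms : ℕ → List (List ℕ)
perms d = filterᵇ (λ w → allB (λ x → count (x ≡ᵇ_) w ≡ᵇ 1) (oneTo d))
                  (allLists d (oneTo d))

Des : List ℕ → List ℕ
Des τ = filterᵇ (λ j → at τ (suc j) <ᵇ at τ j) (oneTo (length τ ∸ 1))

des : List ℕ → ℕ
des τ = length (Des τ)

maj : List ℕ → ℕ
maj τ = sum (Des τ)

-- Euler–Mahonian polynomial E_d(x,y) = Σ_τ x^des(τ) y^maj(τ), evaluated at
-- the monomials x = a^α b^β and y = a^γ b^δ, as a series in a, b.
EulerMahonianAt : ℕ → (α β γ δ : ℕ) → Series
EulerMahonianAt d α β γ δ =
  foldr (λ τ acc → mono (α * des τ + γ * maj τ) (β * des τ + δ * maj τ) ⊕ acc) zeroS (perms d)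

rhs : ℕ → ℕ → Series
rhs d M =
  prodS (oneTo M) (λ n → EulerMahonianAt d ((n ∸ 1) * d) n 1 0)
  ⊗ inv1m (M * d) (M + 1)
  ⊗ prodS (oneTo M) (λ n → prodS (upTo (suc d)) (λ j → inv1m (n * d ∸ j) n))

{-# OPTIONS --safe #-}
module Submission where

-- Both sides count the same weighted objects.  A diamond is determined by its bottom link m
-- and, for each of its M blocks read from the top, the rise D of the block's top link over the
-- link below it and the rises g ∈ [0, D]^d of its folds over that link; its fold and link sums
-- are linear in m and in the pairs (D, Σg).  Sorting the entries of g decreasingly, ties broken
-- by position, turns g into the permutation τ of its positions together with the gaps
-- e ∈ ℕ^{d+1} of the chain D ≥ g_{τ(1)} ≥ ⋯ ≥ g_{τ(d)} ≥ 0, each lowered by one at a descent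
-- of τ (Carlitz's argument for the Euler–Mahonian distribution); then D = des τ + Σe and
-- Σg = maj τ + Σ k eₖ.
-- So the n-th block contributes a monomial of E_d(a^{(n-1)d} b^n, a) and one of
-- Π_j 1/(1 - a^{nd-j} b^n), and m one of 1/(1 - a^{Md} b^{M+1}).

open import Defs
open import Data.Bool using (Bool; true; false; _∧_; not; T; if_then_else_)
open import Data.Bool.Properties using (T-∧; T-≡)
open import Data.Empty using (⊥; ⊥-elim)
open import Data.List
  using (List; []; _∷_; _++_; map; concatMap; length; foldr; upTo; applyUpTo; filterᵇ; cartesianProduct; zip; reverse; take; drop; _∷ʳ_)
import Data.List.Properties as List
open import Data.List.Membership.Propositional using (_∈_; _∉_; find; lose)
open import Data.List.Membership.Propositional.Properties
open import Data.List.Relation.Binary.Permutation.Propositional using (_↭_; ↭-refl; ↭-reflexive; ↭-sym; ↭-trans; ↭-prep; ↭⇒↭ₛ; module PermutationReasoning)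
import Data.List.Relation.Binary.Permutation.Propositional.Properties as ↭
import Data.List.Relation.Binary.Permutation.Setoid.Properties as ↭ₛ
open import Data.List.Relation.Binary.Pointwise using (Pointwise; []; _∷_; Pointwise-≡⇒≡)
open import Data.List.Relation.Binary.Subset.Propositional using (_⊆_)
open import Data.List.Relation.Unary.All using (All; []; _∷_)
import Data.List.Relation.Unary.All as All
import Data.List.Relation.Unary.All.Properties as All
open import Data.List.Relation.Unary.Any using (here; there)
import Data.List.Relation.Unary.AllPairs as AllPairs
open import Data.List.Relation.Unary.Linked using ([]; [-]; _∷_)
import Data.List.Relation.Unary.Linked as Linked
open import Data.List.Relation.Unary.Unique.Propositional using (Unique; []; _∷_)
import Data.List.Relation.Unary.Unique.Propositional.Properties as Unique
open import Data.Nat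
open import Data.Nat.DivMod using (n%n≡0; [m+n]%n≡m%n; m<n⇒m%n≡m)
open import Data.Nat.ListAction using (sum)
open import Data.Nat.ListAction.Properties using (sum-↭)
open import Data.Nat.Properties
open import Data.Nat.Solver using (module +-*-Solver)
open import Data.Product using (∃-syntax; _×_; _,_; proj₁; proj₂; uncurry)
open import Data.Product.Properties using (≡-dec)
open import Data.Sum using (_⊎_; inj₁; inj₂)
open import Data.Unit using (⊤; tt)
open import Function using (_∘_; Equivalence)
open import Level using (0ℓ)
open import Relation.Binary.Bundles using (DecTotalOrder)
open import Relation.Binary.Definitions using (tri<; tri≈; tri>)
open import Relation.Binary.PropositionalEquality
open import Relation.Nullary using (contradiction)
open import Relation.Nullary.Decidable using (T?; _⊎-dec_; _×-dec_)
open +-*-Solver using (solve; _:=_; con; _:+_; _:*_)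

module _ {A : Set} where

  ∈⇒↭∷ : ∀ {x : A} {ys} → x ∈ ys → ∃[ zs ] ys ↭ x ∷ zs
  ∈⇒↭∷ x∈ys with ys₁ , ys₂ , refl ← ∈-∃++ x∈ys = ys₁ ++ ys₂ , ↭.shift _ ys₁ ys₂

  Unique-resp-↭ : ∀ {xs ys : List A} → xs ↭ ys → Unique xs → Unique ys
  Unique-resp-↭ xs↭ys = ↭ₛ.Unique-resp-↭ (setoid A) (↭⇒↭ₛ xs↭ys)

  ⊆-⊇⇒↭ : ∀ {xs ys : List A} → Unique xs → Unique ys → xs ⊆ ys → ys ⊆ xs → xs ↭ ys
  ⊆-⊇⇒↭ {[]}     {[]}    _ _ _ _ = ↭-refl
  ⊆-⊇⇒↭ {[]}     {_ ∷ _} _ _ _ ys⊆[] with () ← ys⊆[] (here refl)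
  ⊆-⊇⇒↭ {x ∷ xs} (x∉xs ∷ !xs) !ys xs⊆ys ys⊆xs with zs , ys↭ ← ∈⇒↭∷ (xs⊆ys (here refl)) =
    ↭-trans (↭-prep x (⊆-⊇⇒↭ !xs !zs xs⊆zs zs⊆xs)) (↭-sym ys↭)
    where
    x∷zs! : Unique (x ∷ zs)
    x∷zs! = Unique-resp-↭ ys↭ !ys
    x∉zs : All (x ≢_) zs
    x∉zs = AllPairs.head x∷zs!
    !zs : Unique zs
    !zs = AllPairs.tail x∷zs!
    xs⊆zs : xs ⊆ zs
    xs⊆zs z∈xs with ↭.∈-resp-↭ ys↭ (xs⊆ys (there z∈xs))
    ... | here refl  = ⊥-elim (All.lookup x∉xs z∈xs refl)
    ... | there z∈zs = z∈zs
    zs⊆xs : zs ⊆ xs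
    zs⊆xs z∈zs with ys⊆xs (↭.∈-resp-↭ (↭-sym ys↭) (there z∈zs))
    ... | here refl  = ⊥-elim (All.lookup x∉zs z∈zs refl)
    ... | there z∈xs = z∈xs

  Unique-map⁺ : ∀ {B : Set} (f : A → B) {xs} → Unique xs →
                (∀ {x y} → x ∈ xs → y ∈ xs → f x ≡ f y → x ≡ y) → Unique (map f xs)
  Unique-map⁺ f {[]}     []         inj = []
  Unique-map⁺ f {x ∷ xs} (x∉ ∷ !xs) inj =
    All.map⁺ (All.tabulate (λ y∈xs fx≡fy → All.lookup x∉ y∈xs (inj (here refl) (there y∈xs) fx≡fy)))
    ∷ Unique-map⁺ f !xs (λ x∈ y∈ → inj (there x∈) (there y∈))

  Unique-concatMap⁺ : ∀ {B : Set} (h : A → List B) (tag : B → A) {xs} → Unique xs →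
                      (∀ {x} → x ∈ xs → Unique (h x)) →
                      (∀ {x y} → x ∈ xs → y ∈ h x → tag y ≡ x) → Unique (concatMap h xs)
  Unique-concatMap⁺ h tag {[]}     []         !h tagged = []
  Unique-concatMap⁺ h tag {x ∷ xs} (x∉ ∷ !xs) !h tagged =
    Unique.++⁺ (!h (here refl)) (Unique-concatMap⁺ h tag !xs (!h ∘ there) (tagged ∘ there)) disjoint
    where
    disjoint : ∀ {y} → y ∈ h x × y ∈ concatMap h xs → ⊥
    disjoint (y∈hx , y∈rest) with x′ , x′∈xs , y∈hx′ ← find (∈-concatMap⁻ h {xs} y∈rest) =
      All.lookup x∉ x′∈xs (trans (sym (tagged (here refl) y∈hx)) (tagged (there x′∈xs) y∈hx′))

  ∈-concatMap⁺′ : ∀ {B : Set} (h : A → List B) {xs x y} → x ∈ xs → y ∈ h x → y ∈ concatMap h xs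
  ∈-concatMap⁺′ h x∈xs y∈hx = ∈-concatMap⁺ h (lose x∈xs y∈hx)

length-concatMap : ∀ {A B : Set} (h : A → List B) xs → length (concatMap h xs) ≡ sum (map (length ∘ h) xs)
length-concatMap h []       = refl
length-concatMap h (x ∷ xs) = trans (List.length-++ (h x)) (cong (length (h x) +_) (length-concatMap h xs))

length-cartesianProduct : ∀ {A B : Set} (xs : List A) (ys : List B) →
                          length (cartesianProduct xs ys) ≡ length xs * length ys
length-cartesianProduct []       ys = refl
length-cartesianProduct (x ∷ xs) ys =
  trans (List.length-++ (map (x ,_) ys)) (cong₂ _+_ (List.length-map (x ,_) ys) (length-cartesianProduct xs ys))

module _ {A B : Set} where

  map-proj₁-zip : ∀ (xs : List A) (ys : List B) → length xs ≡ length ys → map proj₁ (zip xs ys) ≡ xs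
  map-proj₁-zip []       []       _ = refl
  map-proj₁-zip (x ∷ xs) (y ∷ ys) l = cong (x ∷_) (map-proj₁-zip xs ys (suc-injective l))

  map-proj₂-zip : ∀ (xs : List A) (ys : List B) → length xs ≡ length ys → map proj₂ (zip xs ys) ≡ ys
  map-proj₂-zip []       []       _ = refl
  map-proj₂-zip (x ∷ xs) (y ∷ ys) l = cong (y ∷_) (map-proj₂-zip xs ys (suc-injective l))

  zip-map-proj : ∀ (s : List (A × B)) → zip (map proj₁ s) (map proj₂ s) ≡ s
  zip-map-proj []      = refl
  zip-map-proj (x ∷ s) = cong (x ∷_) (zip-map-proj s)

  ∈-zip⁻ : ∀ (xs : List A) (ys : List B) {x y} → (x , y) ∈ zip xs ys → x ∈ xs × y ∈ ys
  ∈-zip⁻ (x ∷ xs) (y ∷ ys) (here refl) = here refl , here refl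
  ∈-zip⁻ (x ∷ xs) (y ∷ ys) (there x∈) = let a , b = ∈-zip⁻ xs ys x∈ in there a , there b

  zip-map-self : ∀ (F : B → A) ys → zip (map F ys) ys ≡ map (λ y → (F y , y)) ys
  zip-map-self F []       = refl
  zip-map-self F (y ∷ ys) = cong (_ ∷_) (zip-map-self F ys)

length-zip : ∀ {A B : Set} {xs : List A} {ys : List B} {n} → length xs ≡ n → length ys ≡ n → length (zip xs ys) ≡ n
length-zip {xs = xs} {ys} refl length-ys = trans (List.length-zipWith _,_ xs ys) (trans (cong (length xs ⊓_) length-ys) (⊓-idem _))

module _ {A : Set} {P : A → Set} where

  Pointwise-const⁻ : ∀ {ns : List ℕ} {xs} → Pointwise (λ _ → P) ns xs → length xs ≡ length ns × All P xs
  Pointwise-const⁻ []       = refl , []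
  Pointwise-const⁻ (p ∷ ps) = let l , a = Pointwise-const⁻ ps in cong suc l , p ∷ a

  Pointwise-const⁺ : ∀ {ns : List ℕ} {xs} → length xs ≡ length ns → All P xs → Pointwise (λ _ → P) ns xs
  Pointwise-const⁺ {[]}     {[]}     _ []       = []
  Pointwise-const⁺ {n ∷ ns} {x ∷ xs} l (p ∷ ps) = p ∷ Pointwise-const⁺ (suc-injective l) ps

  All-zip⁺ : ∀ {B : Set} {Q : B → Set} {xs ys} → All P xs → All Q ys → All (λ (x , y) → P x × Q y) (zip xs ys)
  All-zip⁺ []       _        = []
  All-zip⁺ (_ ∷ _)  []       = []
  All-zip⁺ (p ∷ ps) (q ∷ qs) = (p , q) ∷ All-zip⁺ ps qs

-- Series as weighted enumerations

infixl 6 _+²_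
_+²_ : ℕ × ℕ → ℕ × ℕ → ℕ × ℕ
(a , b) +² (c , e) = (a + c , b + e)

_≡ᵇ²_ : ℕ × ℕ → ℕ × ℕ → Bool
(a , b) ≡ᵇ² (p , q) = (a ≡ᵇ p) ∧ (b ≡ᵇ q)

T-≡ᵇ²⇒≡ : ∀ {u v} → T (u ≡ᵇ² v) → u ≡ v
T-≡ᵇ²⇒≡ {a , b} {p , q} t = let ta , tb = Equivalence.to T-∧ t in cong₂ _,_ (≡ᵇ⇒≡ a p ta) (≡ᵇ⇒≡ b q tb)

≡⇒T-≡ᵇ² : ∀ {u v} → u ≡ v → T (u ≡ᵇ² v)
≡⇒T-≡ᵇ² {a , b} refl = Equivalence.from T-∧ (≡⇒≡ᵇ a a refl , ≡⇒≡ᵇ b b refl)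

-- A combinatorial model of a series: f p q is the number of x with V x and w x ≡ (p , q).
record Enumeration (f : Series) {A : Set} (V : A → Set) (w : A → ℕ × ℕ) : Set where
  field
    fibre          : ℕ → ℕ → List A
    fibre-unique   : ∀ p q → Unique (fibre p q)
    fibre-sound    : ∀ {p q x} → x ∈ fibre p q → V x × w x ≡ (p , q)
    fibre-complete : ∀ {p q x} → V x → w x ≡ (p , q) → x ∈ fibre p q
    coeff≡length   : ∀ p q → f p q ≡ length (fibre p q)
open Enumeration

Enumeration-unique : ∀ {f g A} {V : A → Set} {w} → Enumeration f V w → Enumeration g V w → ∀ p q → f p q ≡ g p q
Enumeration-unique {f} {g} {V = V} {w} E F p q = begin
  f p q                 ≡⟨ coeff≡length E p q ⟩
  length (fibre E p q)  ≡⟨ ↭.↭-length (⊆-⊇⇒↭ (fibre-unique E p q) (fibre-unique F p q) (fibre-⊆ E F) (fibre-⊆ F E)) ⟩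
  length (fibre F p q)  ≡⟨ coeff≡length F p q ⟨
  g p q                 ∎
  where
  open ≡-Reasoning
  fibre-⊆ : ∀ {f g} (E : Enumeration f V w) (F : Enumeration g V w) → fibre E p q ⊆ fibre F p q
  fibre-⊆ E F x∈ = let v , wx = fibre-sound E x∈ in fibre-complete F v wx

record Correspondence {A B : Set} (V : A → Set) (U : B → Set) : Set where
  field
    to      : A → B
    from    : B → A
    to-V    : ∀ {a} → V a → U (to a)
    from-U  : ∀ {b} → U b → V (from b)
    from∘to : ∀ {a} → V a → from (to a) ≡ a
    to∘from : ∀ {b} → U b → to (from b) ≡ b

module _ {f : Series} {A B : Set} {V : A → Set} {U : B → Set} {w : A → ℕ × ℕ} {u : B → ℕ × ℕ} where

  Enumeration-transport : Enumeration f V w → (c : Correspondence V U) →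
                          (∀ {b} → U b → w (Correspondence.from c b) ≡ u b) → Enumeration f U u
  Enumeration-transport E c weight = record
    { fibre          = λ p q → map to (fibre E p q)
    ; fibre-unique   = λ p q → Unique-map⁺ to (fibre-unique E p q) λ a∈ a′∈ eq →
        trans (sym (from∘to (valid a∈))) (trans (cong from eq) (from∘to (valid a′∈)))
    ; fibre-sound    = sound
    ; fibre-complete = λ {p} {q} ub eq → subst (_∈ map to (fibre E p q)) (to∘from ub)
        (∈-map⁺ to (fibre-complete E (from-U ub) (trans (weight ub) eq)))
    ; coeff≡length   = λ p q → trans (coeff≡length E p q) (sym (List.length-map to (fibre E p q)))
    }
    where
    open Correspondence c
    valid : ∀ {p q a} → a ∈ fibre E p q → V a
    valid = proj₁ ∘ fibre-sound E
    sound : ∀ {p q b} → b ∈ map to (fibre E p q) → U b × u b ≡ (p , q)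
    sound b∈ with a , a∈ , refl ← ∈-map⁻ to b∈ =
      let va , wa = fibre-sound E a∈ in
      to-V va , trans (sym (weight (to-V va))) (trans (cong w (from∘to va)) wa)

Enumeration-filter : ∀ {f A} {V : A → Set} {w : A → ℕ × ℕ}
  (candidates : ℕ → ℕ → List A) (P : ℕ → ℕ → A → Bool) →
  (∀ p q → Unique (candidates p q)) →
  (∀ {p q x} → x ∈ candidates p q → T (P p q x) → V x × w x ≡ (p , q)) →
  (∀ {p q x} → V x → w x ≡ (p , q) → x ∈ candidates p q × T (P p q x)) →
  (∀ p q → f p q ≡ count (P p q) (candidates p q)) → Enumeration f V w
Enumeration-filter candidates P unique sound complete coeff = record
  { fibre          = λ p q → filterᵇ (P p q) (candidates p q)
  ; fibre-unique   = λ p q → Unique.filter⁺ (T? ∘ P p q) (unique p q)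
  ; fibre-sound    = λ {p} {q} x∈ → let x∈c , t = ∈-filter⁻ (T? ∘ P p q) x∈ in sound x∈c t
  ; fibre-complete = λ {p} {q} v eq → let x∈c , t = complete v eq in ∈-filter⁺ (T? ∘ P p q) x∈c t
  ; coeff≡length   = coeff
  }

Stack : ∀ {A : Set} → ℕ → (A → Set) → ℕ × List A → Set
Stack M V (_ , xs) = length xs ≡ M × All V xs

Correspondence-Stack : ∀ {A B : Set} {V : A → Set} {U : B → Set} M → Correspondence V U → Correspondence (Stack M V) (Stack M U)
Correspondence-Stack M c = record
  { to      = λ (m , xs) → m , map to xs
  ; from    = λ (m , ys) → m , map from ys
  ; to-V    = λ {(_ , xs)} (l , vs) → trans (List.length-map to xs) l , All.map⁺ (All.map to-V vs)
  ; from-U  = λ {(_ , ys)} (l , us) → trans (List.length-map from ys) l , All.map⁺ (All.map from-U us)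
  ; from∘to = λ {(_ , xs)} (_ , vs) → cong (_ ,_) (trans (sym (List.map-∘ xs)) (List.map-id-local (All.map from∘to vs)))
  ; to∘from = λ {(_ , ys)} (_ , us) → cong (_ ,_) (trans (sym (List.map-∘ ys)) (List.map-id-local (All.map to∘from us)))
  }
  where open Correspondence c

module _ {f g : Series} {A B : Set} {V : A → Set} {U : B → Set} {w : A → ℕ × ℕ} {u : B → ℕ × ℕ} where

  Enumeration-⊗ : Enumeration f V w → Enumeration g U u →
                  Enumeration (f ⊗ g) (λ x → V (proj₁ x) × U (proj₂ x)) (λ x → w (proj₁ x) +² u (proj₂ x))
  Enumeration-⊗ E F = record
    { fibre          = pairs
    ; fibre-unique   = unique
    ; fibre-sound    = sound
    ; fibre-complete = complete
    ; coeff≡length   = coeff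
    }
    where
    block : ℕ → ℕ → ℕ → ℕ → List (A × B)
    block p q i j = cartesianProduct (fibre E i j) (fibre F (p ∸ i) (q ∸ j))
    row : ℕ → ℕ → ℕ → List (A × B)
    row p q i = concatMap (block p q i) (upTo (suc q))
    pairs : ℕ → ℕ → List (A × B)
    pairs p q = concatMap (row p q) (upTo (suc p))

    ∈-block⁻ : ∀ {p q i j a b} → (a , b) ∈ block p q i j →
               (V a × w a ≡ (i , j)) × (U b × u b ≡ (p ∸ i , q ∸ j))
    ∈-block⁻ {p} {q} {i} {j} ab∈ =
      let a∈ , b∈ = ∈-cartesianProduct⁻ (fibre E i j) (fibre F (p ∸ i) (q ∸ j)) ab∈
      in fibre-sound E a∈ , fibre-sound F b∈

    ∈-pairs⁻ : ∀ {p q x} → x ∈ pairs p q → ∃[ i ] ∃[ j ] i ≤ p × j ≤ q × x ∈ block p q i j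
    ∈-pairs⁻ {p} {q} x∈ with i , i∈ , x∈row ← find (∈-concatMap⁻ (row p q) {upTo (suc p)} x∈)
                         with j , j∈ , x∈blk ← find (∈-concatMap⁻ (block p q i) {upTo (suc q)} x∈row) =
      i , j , s≤s⁻¹ (∈-upTo⁻ i∈) , s≤s⁻¹ (∈-upTo⁻ j∈) , x∈blk

    unique : ∀ p q → Unique (pairs p q)
    unique p q = Unique-concatMap⁺ (row p q) (proj₁ ∘ w ∘ proj₁) (Unique.upTo⁺ (suc p))
      (λ {i} _ → Unique-concatMap⁺ (block p q i) (proj₂ ∘ w ∘ proj₁) (Unique.upTo⁺ (suc q))
         (λ {j} _ → Unique.cartesianProduct⁺ (fibre-unique E i j) (fibre-unique F (p ∸ i) (q ∸ j)))
         (λ _ x∈ → cong proj₂ (proj₂ (proj₁ (∈-block⁻ x∈)))))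
      (λ {i} _ x∈ → let j , _ , x∈blk = find (∈-concatMap⁻ (block p q i) {upTo (suc q)} x∈)
                    in cong proj₁ (proj₂ (proj₁ (∈-block⁻ x∈blk))))

    sound : ∀ {p q x} → x ∈ pairs p q → (V (proj₁ x) × U (proj₂ x)) × w (proj₁ x) +² u (proj₂ x) ≡ (p , q)
    sound x∈ with i , j , i≤p , j≤q , x∈blk ← ∈-pairs⁻ x∈
               with (va , refl) , (ub , wb) ← ∈-block⁻ x∈blk =
      (va , ub) , cong₂ _,_ (trans (cong (i +_) (cong proj₁ wb)) (m+[n∸m]≡n i≤p))
                            (trans (cong (j +_) (cong proj₂ wb)) (m+[n∸m]≡n j≤q))

    complete : ∀ {p q x} → V (proj₁ x) × U (proj₂ x) → w (proj₁ x) +² u (proj₂ x) ≡ (p , q) → x ∈ pairs p q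
    complete {p} {q} {a , b} (va , ub) refl =
      ∈-concatMap⁺′ (row p q) {upTo (suc p)} (∈-upTo⁺ (s≤s (m≤m+n i _)))
        (∈-concatMap⁺′ (block p q i) {upTo (suc q)} (∈-upTo⁺ (s≤s (m≤m+n j _)))
          (∈-cartesianProduct⁺ (fibre-complete E va refl)
                               (fibre-complete F ub (sym (cong₂ _,_ (m+n∸m≡n i _) (m+n∸m≡n j _))))))
      where
      i : ℕ
      i = proj₁ (w a)
      j : ℕ
      j = proj₂ (w a)

    coeff : ∀ p q → (f ⊗ g) p q ≡ length (pairs p q)
    coeff p q = sym (begin
      length (pairs p q)
        ≡⟨ length-concatMap (row p q) (upTo (suc p)) ⟩
      sum (map (length ∘ row p q) (upTo (suc p)))
        ≡⟨ cong sum (List.map-cong (λ i → length-concatMap (block p q i) (upTo (suc q))) (upTo (suc p))) ⟩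
      sum (map (λ i → sum (map (length ∘ block p q i) (upTo (suc q)))) (upTo (suc p)))
        ≡⟨ cong sum (List.map-cong (λ i → cong sum (List.map-cong (λ j →
             trans (length-cartesianProduct (fibre E i j) _)
                   (sym (cong₂ _*_ (coeff≡length E i j) (coeff≡length F (p ∸ i) (q ∸ j))))) (upTo (suc q)))) (upTo (suc p))) ⟩
      (f ⊗ g) p q ∎)
      where open ≡-Reasoning

Enumeration-mono : ∀ i j → Enumeration (mono i j) (λ (_ : ⊤) → ⊤) (λ _ → (i , j))
Enumeration-mono i j = Enumeration-filter (λ _ _ → tt ∷ []) (λ p q _ → (i , j) ≡ᵇ² (p , q))
  (λ _ _ → [] ∷ [])
  (λ { (here refl) t → tt , T-≡ᵇ²⇒≡ t })
  (λ _ eq → here refl , ≡⇒T-≡ᵇ² eq)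
  coeff
  where
  coeff : ∀ p q → mono i j p q ≡ count (λ _ → (i , j) ≡ᵇ² (p , q)) (tt ∷ [])
  coeff p q with i ≡ᵇ p | j ≡ᵇ q
  ... | true  | true  = refl
  ... | true  | false = refl
  ... | false | _     = refl

Enumeration-inv1m : ∀ i j → 1 ≤ j → Enumeration (inv1m i j) (λ (_ : ℕ) → ⊤) (λ k → (k * i , k * j))
Enumeration-inv1m i j 1≤j = Enumeration-filter (λ p q → upTo (suc (p + q))) (λ p q k → (k * i , k * j) ≡ᵇ² (p , q))
  (λ _ _ → Unique.upTo⁺ _)
  (λ _ t → tt , T-≡ᵇ²⇒≡ t)
  (λ { {x = k} _ refl → ∈-upTo⁺ (s≤s (≤-trans (m≤m*n k j ⦃ >-nonZero 1≤j ⦄) (m≤n+m (k * j) (k * i))))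
                      , ≡⇒T-≡ᵇ² {k * i , k * j} refl })
  (λ _ _ → refl)

module _ {X : Set} (a b : X → ℕ) where

  sumOfMonomials : List X → Series
  sumOfMonomials = foldr (λ x acc → mono (a x) (b x) ⊕ acc) zeroS

  Enumeration-sumOfMonomials : ∀ xs → Unique xs → Enumeration (sumOfMonomials xs) (_∈ xs) (λ x → (a x , b x))
  Enumeration-sumOfMonomials xs !xs = Enumeration-filter (λ _ _ → xs) (λ p q x → (a x , b x) ≡ᵇ² (p , q))
    (λ _ _ → !xs)
    (λ x∈ t → x∈ , T-≡ᵇ²⇒≡ t)
    (λ x∈ eq → x∈ , ≡⇒T-≡ᵇ² eq)
    (coeff xs)
    where
    coeff : ∀ ys p q → sumOfMonomials ys p q ≡ count (λ x → (a x , b x) ≡ᵇ² (p , q)) ys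
    coeff []       p q = refl
    coeff (y ∷ ys) p q with a y ≡ᵇ p | b y ≡ᵇ q
    ... | true  | true  = cong suc (coeff ys p q)
    ... | true  | false = coeff ys p q
    ... | false | _     = coeff ys p q

weightSum : ∀ {X : Set} → (ℕ → X → ℕ × ℕ) → List ℕ → List X → ℕ × ℕ
weightSum w (n ∷ ns) (x ∷ xs) = w n x +² weightSum w ns xs
weightSum w _        _        = (0 , 0)

-- The default x₀ only serves to make the inverse correspondence total.
Enumeration-prodS : ∀ {X : Set} (x₀ : X) ns {F : ℕ → Series} {V : ℕ → X → Set} {w : ℕ → X → ℕ × ℕ} →
                    (∀ {n} → n ∈ ns → Enumeration (F n) (V n) (w n)) →
                    Enumeration (prodS ns F) (Pointwise V ns) (weightSum w ns)
Enumeration-prodS x₀ [] _ = Enumeration-transport (Enumeration-mono 0 0) nil λ { [] → refl }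
  where
  nil : Correspondence (λ (_ : ⊤) → ⊤) (Pointwise _ [])
  nil = record { to = λ _ → [] ; from = λ _ → tt ; to-V = λ _ → [] ; from-U = λ _ → tt
               ; from∘to = λ _ → refl ; to∘from = λ { [] → refl } }
Enumeration-prodS {X} x₀ (n ∷ ns) {V = V} E =
  Enumeration-transport (Enumeration-⊗ (E (here refl)) (Enumeration-prodS x₀ ns (E ∘ there))) cons
    λ { (_ ∷ _) → refl }
  where
  uncons : List X → X × List X
  uncons []       = x₀ , []
  uncons (x ∷ xs) = x , xs
  cons : Correspondence (λ x → V n (proj₁ x) × Pointwise V ns (proj₂ x)) (Pointwise V (n ∷ ns))
  cons = record { to = λ (x , xs) → x ∷ xs ; from = uncons
                ; to-V = λ (v , vs) → v ∷ vs ; from-U = λ { (v ∷ vs) → v , vs }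
                ; from∘to = λ _ → refl ; to∘from = λ { (_ ∷ _) → refl } }

+²-interchange : ∀ a b c e → (a +² b) +² (c +² e) ≡ (a +² c) +² (b +² e)
+²-interchange (a₁ , a₂) (b₁ , b₂) (c₁ , c₂) (e₁ , e₂) =
  cong₂ _,_ (interchange a₁ b₁ c₁ e₁) (interchange a₂ b₂ c₂ e₂)
  where
  interchange : ∀ a b c e → (a + b) + (c + e) ≡ (a + c) + (b + e)
  interchange = solve 4 (λ a b c e → (a :+ b) :+ (c :+ e) := (a :+ c) :+ (b :+ e)) refl

+²-assoc : ∀ a b c → (a +² b) +² c ≡ a +² (b +² c)
+²-assoc (a₁ , a₂) (b₁ , b₂) (c₁ , c₂) = cong₂ _,_ (+-assoc a₁ b₁ c₁) (+-assoc a₂ b₂ c₂)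

+²-swapʳ : ∀ a b c → (a +² b) +² c ≡ (a +² c) +² b
+²-swapʳ (a₁ , a₂) (b₁ , b₂) (c₁ , c₂) = cong₂ _,_ (swap a₁ b₁ c₁) (swap a₂ b₂ c₂)
  where
  swap : ∀ a b c → (a + b) + c ≡ (a + c) + b
  swap = solve 3 (λ a b c → (a :+ b) :+ c := (a :+ c) :+ b) refl

module _ {X : Set} where

  weightSum-mapᵢ : ∀ (w : ℕ → X → ℕ × ℕ) f ns xs → weightSum w (map f ns) xs ≡ weightSum (w ∘ f) ns xs
  weightSum-mapᵢ w f []       xs       = refl
  weightSum-mapᵢ w f (n ∷ ns) []       = refl
  weightSum-mapᵢ w f (n ∷ ns) (x ∷ xs) = cong (w (f n) x +²_) (weightSum-mapᵢ w f ns xs)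

  weightSum-map : ∀ {Y : Set} (w : ℕ → X → ℕ × ℕ) (f : Y → X) ns xs → weightSum w ns (map f xs) ≡ weightSum (λ n → w n ∘ f) ns xs
  weightSum-map w f []       xs       = refl
  weightSum-map w f (n ∷ ns) []       = refl
  weightSum-map w f (n ∷ ns) (x ∷ xs) = cong (w n (f x) +²_) (weightSum-map w f ns xs)

  weightSum-cong : ∀ {P : X → Set} {w w′ : ℕ → X → ℕ × ℕ} ns {xs} → (∀ n {x} → P x → w n x ≡ w′ n x) →
                   All P xs → weightSum w ns xs ≡ weightSum w′ ns xs
  weightSum-cong []       w≗w′ _          = refl
  weightSum-cong (n ∷ ns) w≗w′ []         = refl
  weightSum-cong (n ∷ ns) w≗w′ (px ∷ pxs) = cong₂ _+²_ (w≗w′ n px) (weightSum-cong ns w≗w′ pxs)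

  weightSum-+² : ∀ (f g : ℕ → X → ℕ × ℕ) ns xs →
                weightSum f ns xs +² weightSum g ns xs ≡ weightSum (λ n x → f n x +² g n x) ns xs
  weightSum-+² f g []       xs       = refl
  weightSum-+² f g (n ∷ ns) []       = refl
  weightSum-+² f g (n ∷ ns) (x ∷ xs) =
    trans (+²-interchange (f n x) _ (g n x) _) (cong (f n x +² g n x +²_) (weightSum-+² f g ns xs))

  weightSum-∷ʳ : ∀ (w : ℕ → X → ℕ × ℕ) ns xs n x → length ns ≡ length xs →
                 weightSum w (ns ∷ʳ n) (xs ∷ʳ x) ≡ weightSum w ns xs +² w n x
  weightSum-∷ʳ w []       []       n x _ = cong₂ _,_ (+-identityʳ _) (+-identityʳ _)
  weightSum-∷ʳ w (m ∷ ns) (y ∷ xs) n x l =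
    trans (cong (w m y +²_) (weightSum-∷ʳ w ns xs n x (suc-injective l))) (sym (+²-assoc (w m y) _ (w n x)))


∈-allLists⁻ : ∀ k vals {xs} → xs ∈ allLists k vals → length xs ≡ k × All (_∈ vals) xs
∈-allLists⁻ zero    vals (here refl) = refl , []
∈-allLists⁻ (suc k) vals xs∈
  with v , v∈ , xs∈′ ← find (∈-concatMap⁻ (λ v → map (v ∷_) (allLists k vals)) {vals} xs∈)
  with ys , ys∈ , refl ← ∈-map⁻ (v ∷_) xs∈′ =
  let length≡ , entries = ∈-allLists⁻ k vals ys∈ in cong suc length≡ , v∈ ∷ entries

∈-allLists⁺ : ∀ k vals {xs} → length xs ≡ k → All (_∈ vals) xs → xs ∈ allLists k vals
∈-allLists⁺ zero    vals {[]}     refl []         = here refl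
∈-allLists⁺ (suc k) vals {v ∷ xs} refl (v∈ ∷ xs∈) =
  ∈-concatMap⁺′ (λ v → map (v ∷_) (allLists k vals)) v∈ (∈-map⁺ (v ∷_) (∈-allLists⁺ k vals refl xs∈))

allLists-unique : ∀ k vals → Unique vals → Unique (allLists k vals)
allLists-unique zero    vals !vals = [] ∷ []
allLists-unique (suc k) vals !vals =
  Unique-concatMap⁺ (λ v → map (v ∷_) (allLists k vals)) head !vals
    (λ _ → Unique.map⁺ List.∷-injectiveʳ (allLists-unique k vals !vals))
    (λ _ xs∈ → let _ , _ , eq = ∈-map⁻ _ xs∈ in cong head eq)
  where
  head : List ℕ → ℕ
  head []      = 0
  head (x ∷ _) = x

∈⇒≤sum : ∀ {x} xs → x ∈ xs → x ≤ sum xs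
∈⇒≤sum (y ∷ xs) (here refl) = m≤m+n y (sum xs)
∈⇒≤sum (y ∷ xs) (there x∈)  = ≤-trans (∈⇒≤sum xs x∈) (m≤n+m (sum xs) y)

selectSum : (ℕ → Bool) → List ℕ → ℕ
selectSum P []       = 0
selectSum P (x ∷ xs) = (if P 1 then x else 0) + selectSum (P ∘ suc) xs

sum-at-filter : ∀ P a → sum (map (at a) (filterᵇ P (oneTo (length a)))) ≡ selectSum P a
sum-at-filter P []       = refl
sum-at-filter P (x ∷ xs) = begin
  sum (map (at (x ∷ xs)) (filterᵇ P (1 ∷ map suc (applyUpTo suc n))))
    ≡⟨ cong (λ js → sum (map (at (x ∷ xs)) (filterᵇ P (1 ∷ map suc js)))) (List.map-upTo suc n) ⟨
  sum (map (at (x ∷ xs)) (filterᵇ P (1 ∷ map suc (map suc (upTo n)))))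
    ≡⟨ first+rest ⟩
  (if P 1 then x else 0) + selectSum (P ∘ suc) xs ∎
  where
  open ≡-Reasoning
  n : ℕ
  n = length xs
  shift : ∀ js → map (at (x ∷ xs)) (filterᵇ P (map suc (map suc js))) ≡ map (at xs) (filterᵇ (P ∘ suc) (map suc js))
  shift []       = refl
  shift (j ∷ js) with P (suc (suc j))
  ... | true  = cong (at xs (suc j) ∷_) (shift js)
  ... | false = shift js
  rest : sum (map (at (x ∷ xs)) (filterᵇ P (map suc (map suc (upTo n))))) ≡ selectSum (P ∘ suc) xs
  rest = trans (cong sum (shift (upTo n))) (sum-at-filter (P ∘ suc) xs)
  first+rest : sum (map (at (x ∷ xs)) (filterᵇ P (1 ∷ map suc (map suc (upTo n))))) ≡ (if P 1 then x else 0) + selectSum (P ∘ suc) xs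
  first+rest with P 1
  ... | true  = cong (x +_) rest
  ... | false = rest

selectSum-complement : ∀ P a → selectSum (not ∘ P) a + selectSum P a ≡ sum a
selectSum-complement P []       = refl
selectSum-complement P (x ∷ xs) with P 1 | selectSum-complement (P ∘ suc) xs
... | true  | ih = trans (solve 3 (λ s t x → s :+ (x :+ t) := x :+ (s :+ t)) refl (selectSum (not ∘ P ∘ suc) xs) (selectSum (P ∘ suc) xs) x)
                        (cong (x +_) ih)
... | false | ih = trans (+-assoc x _ _) (cong (x +_) ih)

selectSum-++ : ∀ P xs ys → selectSum P (xs ++ ys) ≡ selectSum P xs + selectSum (λ j → P (length xs + j)) ys
selectSum-++ P []       ys = refl
selectSum-++ P (x ∷ xs) ys =
  trans (cong (_ +_) (selectSum-++ (P ∘ suc) xs ys)) (sym (+-assoc (if P 1 then x else 0) _ _))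

selectSum-cong : ∀ {P Q} xs → (∀ j → P j ≡ Q j) → selectSum P xs ≡ selectSum Q xs
selectSum-cong []       P≗Q = refl
selectSum-cong (x ∷ xs) P≗Q rewrite P≗Q 1 = cong (_ +_) (selectSum-cong xs (P≗Q ∘ suc))

selectSum-none : ∀ P xs → (∀ j → 1 ≤ j → j ≤ length xs → P j ≡ false) → selectSum P xs ≡ 0
selectSum-none P []       _    = refl
selectSum-none P (x ∷ xs) none rewrite none 1 ≤-refl (s≤s z≤n) =
  selectSum-none (P ∘ suc) xs λ j _ j≤ → none (suc j) (s≤s z≤n) (s≤s j≤)

selectSum-all : ∀ P xs → (∀ j → 1 ≤ j → j ≤ length xs → P j ≡ true) → selectSum P xs ≡ sum xs
selectSum-all P []       _   = refl
selectSum-all P (x ∷ xs) all rewrite all 1 ≤-refl (s≤s z≤n) =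
  cong (x +_) (selectSum-all (P ∘ suc) xs λ j _ j≤ → all (suc j) (s≤s z≤n) (s≤s j≤))

foldSum+linkSum≡sum : ∀ d a → foldSum d a + linkSum d a ≡ sum a
foldSum+linkSum≡sum d a =
  trans (cong₂ _+_ (sum-at-filter (not ∘ isLink d) a) (sum-at-filter (isLink d) a)) (selectSum-complement (isLink d) a)

length-isDiamond : ∀ d M a → T (isDiamond d M a) → length a ≡ len d M
length-isDiamond d M a isD = ≡ᵇ⇒≡ _ _ (proj₁ (Equivalence.to (T-∧ {length a ≡ᵇ len d M}) isD))

Enumeration-sigma : ∀ d M → Enumeration (sigma d M) (T ∘ isDiamond d M) (λ a → (foldSum d a , linkSum d a))
Enumeration-sigma d M = Enumeration-filter
  (λ p q → allLists (len d M) (upTo (suc (p + q))))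
  (λ p q a → isDiamond d M a ∧ (foldSum d a , linkSum d a) ≡ᵇ² (p , q))
  (λ p q → allLists-unique (len d M) _ (Unique.upTo⁺ _))
  (λ _ t → let isD , eq = Equivalence.to T-∧ t in isD , T-≡ᵇ²⇒≡ eq)
  complete
  (λ _ _ → refl)
  where
  complete : ∀ {p q a} → T (isDiamond d M a) → (foldSum d a , linkSum d a) ≡ (p , q) →
             a ∈ allLists (len d M) (upTo (suc (p + q))) × T (isDiamond d M a ∧ (foldSum d a , linkSum d a) ≡ᵇ² (p , q))
  complete {a = a} isD refl =
    ∈-allLists⁺ _ _ (length-isDiamond d M a isD)
      (All.tabulate λ x∈ → ∈-upTo⁺ (s≤s (≤-trans (∈⇒≤sum a x∈) (≤-reflexive (sym (foldSum+linkSum≡sum d a))))))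
    , Equivalence.from T-∧ (isD , ≡⇒T-≡ᵇ² {foldSum d a , linkSum d a} refl)

allB⁻ : ∀ {A : Set} (P : A → Bool) xs → T (allB P xs) → All (T ∘ P) xs
allB⁻ P []       _ = []
allB⁻ P (x ∷ xs) t = let px , rest = Equivalence.to T-∧ t in px ∷ allB⁻ P xs rest

allB⁺ : ∀ {A : Set} (P : A → Bool) xs → All (T ∘ P) xs → T (allB P xs)
allB⁺ P []       []         = tt
allB⁺ P (x ∷ xs) (px ∷ pxs) = Equivalence.from T-∧ (px , allB⁺ P xs pxs)

count-pos⇒∈ : ∀ x xs → 0 < count (x ≡ᵇ_) xs → x ∈ xs
count-pos⇒∈ x (y ∷ xs) pos with x ≡ᵇ y in eq
... | true  = here (≡ᵇ⇒≡ x y (subst T (sym eq) tt))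
... | false = there (count-pos⇒∈ x xs pos)

∉⇒count≡0 : ∀ x xs → x ∉ xs → count (x ≡ᵇ_) xs ≡ 0
∉⇒count≡0 x xs x∉ = n≤0⇒n≡0 (≮⇒≥ (x∉ ∘ count-pos⇒∈ x xs))

count-∷-≤ : ∀ x y xs → count (x ≡ᵇ_) xs ≤ count (x ≡ᵇ_) (y ∷ xs)
count-∷-≤ x y xs with x ≡ᵇ y
... | true  = n≤1+n _
... | false = ≤-refl

∈⇒count-pos : ∀ x xs → x ∈ xs → 0 < count (x ≡ᵇ_) xs
∈⇒count-pos x (y ∷ xs) (here refl) with x ≡ᵇ x in eq
... | true  = s≤s z≤n
... | false = ⊥-elim (subst T eq (≡⇒≡ᵇ x x refl))
∈⇒count-pos x (y ∷ xs) (there x∈) = ≤-trans (∈⇒count-pos x xs x∈) (count-∷-≤ x y xs)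

count≤1⇒Unique : ∀ xs → (∀ {x} → x ∈ xs → count (x ≡ᵇ_) xs ≤ 1) → Unique xs
count≤1⇒Unique []       _  = []
count≤1⇒Unique (y ∷ xs) ≤1 =
  All.tabulate (λ z∈ y≡z → y∉xs (subst (_∈ xs) (sym y≡z) z∈))
  ∷ count≤1⇒Unique xs (λ {x} x∈ → ≤-trans (count-∷-≤ x y xs) (≤1 (there x∈)))
  where
  y∉xs : y ∉ xs
  y∉xs y∈ with y ≡ᵇ y in eq | ≤1 (here refl)
  ... | true  | s≤s c≤0 = <⇒≱ (∈⇒count-pos y xs y∈) c≤0
  ... | false | _       = subst T eq (≡⇒≡ᵇ y y refl)

Unique⇒count≡1 : ∀ {x xs} → Unique xs → x ∈ xs → count (x ≡ᵇ_) xs ≡ 1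
Unique⇒count≡1 {x} {y ∷ xs} (y∉ ∷ !xs) x∈ with x ≡ᵇ y in eq | x∈
... | true  | _          =
  cong suc (∉⇒count≡0 x xs λ x∈xs → All.lookup y∉ x∈xs (sym (≡ᵇ⇒≡ x y (subst T (sym eq) tt))))
... | false | here refl  = ⊥-elim (subst T eq (≡⇒≡ᵇ x x refl))
... | false | there x∈xs = Unique⇒count≡1 !xs x∈xs

count-resp-↭ : ∀ (P : ℕ → Bool) {xs ys} → xs ↭ ys → count P xs ≡ count P ys
count-resp-↭ P xs↭ys = ↭.↭-length (↭.filter-↭ (T? ∘ P) xs↭ys)

length-oneTo : ∀ n → length (oneTo n) ≡ n
length-oneTo n = trans (List.length-map suc (upTo n)) (List.length-upTo n)

oneTo-unique : ∀ n → Unique (oneTo n)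
oneTo-unique n = Unique.map⁺ suc-injective (Unique.upTo⁺ n)

∈-oneTo⁻ : ∀ {i n} → i ∈ oneTo n → 1 ≤ i × i ≤ n
∈-oneTo⁻ i∈ with j , j∈ , refl ← ∈-map⁻ suc i∈ = s≤s z≤n , ∈-upTo⁻ j∈

module _ (d : ℕ) where

  private
    isPerm : List ℕ → Bool
    isPerm w = allB (λ x → count (x ≡ᵇ_) w ≡ᵇ 1) (oneTo d)

  perms-unique : Unique (perms d)
  perms-unique = Unique.filter⁺ (T? ∘ isPerm) (allLists-unique d (oneTo d) (oneTo-unique d))

  ∈-perms⁻ : ∀ {τ} → τ ∈ perms d → τ ↭ oneTo d
  ∈-perms⁻ {τ} τ∈ with τ∈lists , t ← ∈-filter⁻ (T? ∘ isPerm) {xs = allLists d (oneTo d)} τ∈ =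
    ⊆-⊇⇒↭ !τ (oneTo-unique d) (All.lookup entries) (λ x∈ → count-pos⇒∈ _ τ (≤-reflexive (sym (once x∈))))
    where
    entries : All (_∈ oneTo d) τ
    entries = proj₂ (∈-allLists⁻ d (oneTo d) τ∈lists)
    once : ∀ {x} → x ∈ oneTo d → count (x ≡ᵇ_) τ ≡ 1
    once x∈ = ≡ᵇ⇒≡ _ _ (All.lookup (allB⁻ _ (oneTo d) t) x∈)
    !τ : Unique τ
    !τ = count≤1⇒Unique τ (≤-reflexive ∘ once ∘ All.lookup entries)

  ∈-perms⁺ : ∀ {τ} → τ ↭ oneTo d → τ ∈ perms d
  ∈-perms⁺ {τ} τ↭ = ∈-filter⁺ (T? ∘ isPerm)
    (∈-allLists⁺ d (oneTo d) (trans (↭.↭-length τ↭) (length-oneTo d)) (All.tabulate (↭.∈-resp-↭ τ↭)))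
    (allB⁺ _ (oneTo d) (All.tabulate λ {x} x∈ →
      ≡⇒≡ᵇ _ _ (trans (count-resp-↭ (x ≡ᵇ_) τ↭) (Unique⇒count≡1 (oneTo-unique d) x∈))))

leadingDescent : ℕ → List ℕ → ℕ
leadingDescent i []      = 0
leadingDescent i (j ∷ _) = if j <ᵇ i then 1 else 0

Des-∷∷ : ∀ i j r → Des (i ∷ j ∷ r) ≡ (if j <ᵇ i then 1 ∷ map suc (Des (j ∷ r)) else map suc (Des (j ∷ r)))
Des-∷∷ i j r = begin
  filterᵇ P (1 ∷ map suc (applyUpTo suc n))
    ≡⟨ cong (λ ks → filterᵇ P (1 ∷ map suc ks)) (List.map-upTo suc n) ⟨
  filterᵇ P (1 ∷ map suc (map suc (upTo n)))
    ≡⟨ first+rest ⟩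
  (if j <ᵇ i then 1 ∷ map suc (Des (j ∷ r)) else map suc (Des (j ∷ r))) ∎
  where
  open ≡-Reasoning
  n : ℕ
  n = length r
  P : ℕ → Bool
  P k = at (i ∷ j ∷ r) (suc k) <ᵇ at (i ∷ j ∷ r) k
  P′ : ℕ → Bool
  P′ k = at (j ∷ r) (suc k) <ᵇ at (j ∷ r) k
  shift : ∀ ks → filterᵇ P (map suc (map suc ks)) ≡ map suc (filterᵇ P′ (map suc ks))
  shift []       = refl
  shift (k ∷ ks) with P′ (suc k)
  ... | true  = cong (suc (suc k) ∷_) (shift ks)
  ... | false = shift ks
  first+rest : filterᵇ P (1 ∷ map suc (map suc (upTo n))) ≡ (if j <ᵇ i then 1 ∷ map suc (Des (j ∷ r)) else map suc (Des (j ∷ r)))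
  first+rest with j <ᵇ i
  ... | true  = cong (1 ∷_) (shift (upTo n))
  ... | false = shift (upTo n)

des-∷ : ∀ i τ → des (i ∷ τ) ≡ leadingDescent i τ + des τ
des-∷ i []      = refl
des-∷ i (j ∷ r) rewrite Des-∷∷ i j r with j <ᵇ i
... | true  = cong suc (List.length-map suc (Des (j ∷ r)))
... | false = List.length-map suc (Des (j ∷ r))

sum-map-suc : ∀ xs → sum (map suc xs) ≡ sum xs + length xs
sum-map-suc []       = refl
sum-map-suc (x ∷ xs) = trans (cong (suc x +_) (sum-map-suc xs))
  (solve 3 (λ x s n → con 1 :+ x :+ (s :+ n) := x :+ s :+ (con 1 :+ n)) refl x (sum xs) (length xs))

maj-∷ : ∀ i τ → maj (i ∷ τ) ≡ leadingDescent i τ + maj τ + des τ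
maj-∷ i []      = refl
maj-∷ i (j ∷ r) rewrite Des-∷∷ i j r with j <ᵇ i
... | true  = cong suc (sum-map-suc (Des (j ∷ r)))
... | false = sum-map-suc (Des (j ∷ r))

-- Carlitz's bijection

_≼_ : ℕ × ℕ → ℕ × ℕ → Set
(v , i) ≼ (v′ , i′) = v′ < v ⊎ (v ≡ v′ × i ≤ i′)

≼-trans : ∀ {x y z} → x ≼ y → y ≼ z → x ≼ z
≼-trans (inj₁ a)          (inj₁ b)          = inj₁ (<-trans b a)
≼-trans (inj₁ a)          (inj₂ (refl , _)) = inj₁ a
≼-trans (inj₂ (refl , _)) (inj₁ b)          = inj₁ b
≼-trans (inj₂ (refl , a)) (inj₂ (refl , b)) = inj₂ (refl , ≤-trans a b)

≼-antisym : ∀ {x y} → x ≼ y → y ≼ x → x ≡ y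
≼-antisym (inj₁ a)          (inj₁ b)          = ⊥-elim (<-asym a b)
≼-antisym (inj₁ a)          (inj₂ (refl , _)) = ⊥-elim (<-irrefl refl a)
≼-antisym (inj₂ (refl , _)) (inj₁ b)          = ⊥-elim (<-irrefl refl b)
≼-antisym (inj₂ (refl , a)) (inj₂ (_ , b))    = cong (_ ,_) (≤-antisym a b)

≼-total : ∀ x y → x ≼ y ⊎ y ≼ x
≼-total (v , i) (v′ , i′) with <-cmp v v′ | ≤-total i i′
... | tri< v<v′ _ _ | _         = inj₂ (inj₁ v<v′)
... | tri> _ _ v′<v | _         = inj₁ (inj₁ v′<v)
... | tri≈ _ refl _ | inj₁ i≤i′ = inj₁ (inj₂ (refl , i≤i′))
... | tri≈ _ refl _ | inj₂ i′≤i = inj₂ (inj₂ (refl , i′≤i))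

≼-decTotalOrder : DecTotalOrder 0ℓ 0ℓ 0ℓ
≼-decTotalOrder = record
  { Carrier         = ℕ × ℕ
  ; _≈_             = _≡_
  ; _≤_             = _≼_
  ; isDecTotalOrder = record
    { isTotalOrder = record
      { isPartialOrder = record
        { isPreorder = record
          { isEquivalence = isEquivalence
          ; reflexive     = λ { refl → inj₂ (refl , ≤-refl) }
          ; trans         = ≼-trans
          }
        ; antisym = ≼-antisym
        }
      ; total = ≼-total
      }
    ; _≟_  = ≡-dec _≟_ _≟_
    ; _≤?_ = λ (v , i) (v′ , i′) → (v′ <? v) ⊎-dec ((v ≟ v′) ×-dec (i ≤? i′))
    }
  }

open import Data.List.Sort ≼-decTotalOrder using (sort; sort-↭; sort-↗)
open import Data.List.Relation.Unary.Sorted.TotalOrder (DecTotalOrder.totalOrder ≼-decTotalOrder) using (Sorted)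
import Data.List.Relation.Unary.Sorted.TotalOrder.Properties as Sorted

sorted-↭⇒≡ : ∀ {xs ys} → Sorted xs → Sorted ys → xs ↭ ys → xs ≡ ys
sorted-↭⇒≡ xs↗ ys↗ xs↭ys =
  Pointwise-≡⇒≡ (Sorted.↗↭↗⇒≋ (DecTotalOrder.totalOrder ≼-decTotalOrder) xs↗ ys↗ (↭⇒↭ₛ xs↭ys))

-- Sorted pairs decrease strictly in value wherever their indices descend.
≼⇒≤ : ∀ {v i v′ i′} → (v , i) ≼ (v′ , i′) → v′ + (if i′ <ᵇ i then 1 else 0) ≤ v
≼⇒≤ {v} {i} {v′} {i′} v≼ with i′ <ᵇ i in eq | v≼
... | true  | inj₁ v′<v          = subst (_≤ v) (+-comm 1 v′) v′<v
... | true  | inj₂ (refl , i≤i′) = ⊥-elim (<⇒≱ (<ᵇ⇒< i′ i (subst T (sym eq) tt)) i≤i′)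
... | false | inj₁ v′<v          = ≤-trans (≤-reflexive (+-identityʳ v′)) (<⇒≤ v′<v)
... | false | inj₂ (refl , _)    = ≤-reflexive (+-identityʳ v′)

≤⇒≼ : ∀ {v i v′ i′} → v′ + (if i′ <ᵇ i then 1 else 0) ≤ v → (v , i) ≼ (v′ , i′)
≤⇒≼ {v} {i} {v′} {i′} ≤v with i′ <ᵇ i in eq
... | true  = inj₁ (subst (_≤ v) (+-comm v′ 1) ≤v)
... | false with m≤n⇒m<n∨m≡n (subst (_≤ v) (+-identityʳ v′) ≤v)
...   | inj₁ v′<v  = inj₁ v′<v
...   | inj₂ refl = inj₂ (refl , ≮⇒≥ (λ i′<i → subst T eq (<⇒<ᵇ i′<i)))

valueAt : ℕ → List (ℕ × ℕ) → ℕ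
valueAt i []            = 0
valueAt i ((v , j) ∷ s) = if i ≡ᵇ j then v else valueAt i s

valueAt-∈ : ∀ s {v i} → Unique (map proj₂ s) → (v , i) ∈ s → valueAt i s ≡ v
valueAt-∈ ((v , i) ∷ s) _ (here refl) with i ≡ᵇ i in eq
... | true  = refl
... | false = ⊥-elim (subst T eq (≡⇒≡ᵇ i i refl))
valueAt-∈ ((v′ , j) ∷ s) {v} {i} (j∉ ∷ !s) (there vi∈) with i ≡ᵇ j in eq
... | true  = ⊥-elim (All.lookup j∉ (∈-map⁺ proj₂ vi∈) (sym (≡ᵇ⇒≡ i j (subst T (sym eq) tt))))
... | false = valueAt-∈ s !s vi∈

valueAt-≤ : ∀ s i D → All (_≤ D) (map proj₁ s) → valueAt i s ≤ D
valueAt-≤ []            i D _          = z≤n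
valueAt-≤ ((v , j) ∷ s) i D (v≤ ∷ s≤) with i ≡ᵇ j
... | true  = v≤
... | false = valueAt-≤ s i D s≤

-- Σₖ k·eₖ, positions counted from 0.
firstMoment : List ℕ → ℕ
firstMoment []       = 0
firstMoment (x ∷ xs) = firstMoment xs + sum xs

-- Successive differences of u ≥ λ₁ ≥ λ₂ ≥ ⋯, each lowered by one at a descent of τ.
gaps : ℕ → List ℕ → List ℕ → List ℕ
gaps u []      _        = u ∷ []
gaps u (i ∷ τ) []       = []
gaps u (i ∷ τ) (v ∷ λs) = (u ∸ v) ∷ gaps (v ∸ leadingDescent i τ) τ λs

top : List ℕ → List ℕ → ℕ
top []      []       = 0
top []      (e ∷ _)  = e
top (i ∷ τ) []       = 0
top (i ∷ τ) (e ∷ es) = top τ es + leadingDescent i τ + e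

heights : List ℕ → List ℕ → List ℕ
heights (i ∷ τ) (e ∷ es) = top τ es + leadingDescent i τ ∷ heights τ es
heights _       _        = []

length-heights : ∀ τ e → length e ≡ suc (length τ) → length (heights τ e) ≡ length τ
length-heights []      (e ∷ [])  _ = refl
length-heights (i ∷ τ) (e ∷ es)  l = cong suc (length-heights τ es (suc-injective l))

top≡des+sum : ∀ τ e → length e ≡ suc (length τ) → top τ e ≡ des τ + sum e
top≡des+sum []      (e ∷ [])  _ = sym (+-identityʳ e)
top≡des+sum (i ∷ τ) (e ∷ es)  l rewrite des-∷ i τ | top≡des+sum τ es (suc-injective l) =
  solve 4 (λ a b c x → a :+ b :+ c :+ x := c :+ a :+ (x :+ b)) refl (des τ) (sum es) (leadingDescent i τ) e

sum-heights : ∀ τ e → length e ≡ suc (length τ) → sum (heights τ e) ≡ maj τ + firstMoment e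
sum-heights []      (e ∷ [])  _ = refl
sum-heights (i ∷ τ) (e ∷ es)  l
  rewrite maj-∷ i τ | sum-heights τ es (suc-injective l) | top≡des+sum τ es (suc-injective l) =
  solve 5 (λ a b c m w → a :+ b :+ c :+ (m :+ w) := c :+ m :+ a :+ (w :+ b))
    refl (des τ) (sum es) (leadingDescent i τ) (maj τ) (firstMoment es)

gaps-heights : ∀ τ e → length e ≡ suc (length τ) → gaps (top τ e) τ (heights τ e) ≡ e
gaps-heights []      (e ∷ [])  _ = refl
gaps-heights (i ∷ τ) (e ∷ es)  l = cong₂ _∷_ (m+n∸m≡n (top τ es + leadingDescent i τ) e)
  (trans (cong (λ u → gaps u τ (heights τ es)) (m+n∸n≡m (top τ es) (leadingDescent i τ)))
         (gaps-heights τ es (suc-injective l)))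

heights-sorted : ∀ τ e → length e ≡ suc (length τ) → Sorted (zip (heights τ e) τ)
heights-sorted []           (e ∷ [])       _ = []
heights-sorted (i ∷ [])     (e ∷ e′ ∷ [])  _ = [-]
heights-sorted (i ∷ i′ ∷ τ) (e ∷ e′ ∷ es)  l =
  ≤⇒≼ (+-monoˡ-≤ (leadingDescent i (i′ ∷ τ)) (m≤m+n (top τ es + leadingDescent i′ τ) e′))
  ∷ heights-sorted (i′ ∷ τ) (e′ ∷ es) (suc-injective l)

heights-≤top : ∀ τ e → length e ≡ suc (length τ) → All (_≤ top τ e) (heights τ e)
heights-≤top []      (e ∷ [])  _ = []
heights-≤top (i ∷ τ) (e ∷ es)  l =
  m≤m+n _ e ∷ All.map (λ h≤ → ≤-trans h≤ (≤-trans (m≤m+n _ (leadingDescent i τ)) (m≤m+n _ e)))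
                       (heights-≤top τ es (suc-injective l))

length-gaps : ∀ u τ λs → length λs ≡ length τ → length (gaps u τ λs) ≡ suc (length τ)
length-gaps u []      []       _ = refl
length-gaps u (i ∷ τ) (v ∷ λs) l = cong suc (length-gaps _ τ λs (suc-injective l))

HeadBelow : ℕ → List (ℕ × ℕ) → Set
HeadBelow u []            = ⊤
HeadBelow u ((v , _) ∷ _) = v ≤ u

sorted-step : ∀ {v i} s → Sorted ((v , i) ∷ s) →
              leadingDescent i (map proj₂ s) ≤ v × HeadBelow (v ∸ leadingDescent i (map proj₂ s)) s
sorted-step []             [-]       = z≤n , tt
sorted-step ((v′ , _) ∷ _) (vi≼ ∷ _) = m+n≤o⇒n≤o v′ (≼⇒≤ vi≼) , m+n≤o⇒m≤o∸n v′ (≼⇒≤ vi≼)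

top-gaps : ∀ u s → Sorted s → HeadBelow u s → top (map proj₂ s) (gaps u (map proj₂ s) (map proj₁ s)) ≡ u
top-gaps u []            _  _   = refl
top-gaps u ((v , i) ∷ s) s↗ v≤u = begin
  top τ (gaps (v ∸ δ) τ (map proj₁ s)) + δ + (u ∸ v)
    ≡⟨ cong (λ t → t + δ + (u ∸ v)) (top-gaps (v ∸ δ) s (Linked.tail s↗) below) ⟩
  v ∸ δ + δ + (u ∸ v)  ≡⟨ cong (_+ (u ∸ v)) (m∸n+n≡m δ≤v) ⟩
  v + (u ∸ v)          ≡⟨ m+[n∸m]≡n v≤u ⟩
  u                    ∎
  where
  open ≡-Reasoning
  τ : List ℕ
  τ = map proj₂ s
  δ : ℕ
  δ = leadingDescent i τ
  δ≤v : δ ≤ v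
  δ≤v = proj₁ (sorted-step s s↗)
  below : HeadBelow (v ∸ δ) s
  below = proj₂ (sorted-step s s↗)

heights-gaps : ∀ u s → Sorted s → HeadBelow u s →
               heights (map proj₂ s) (gaps u (map proj₂ s) (map proj₁ s)) ≡ map proj₁ s
heights-gaps u []            _  _   = refl
heights-gaps u ((v , i) ∷ s) s↗ v≤u = cong₂ _∷_
  (trans (cong (_+ δ) (top-gaps (v ∸ δ) s (Linked.tail s↗) below)) (m∸n+n≡m δ≤v))
  (heights-gaps (v ∸ δ) s (Linked.tail s↗) below)
  where
  δ : ℕ
  δ = leadingDescent i (map proj₂ s)
  δ≤v : δ ≤ v
  δ≤v = proj₁ (sorted-step s s↗)
  below : HeadBelow (v ∸ δ) s
  below = proj₂ (sorted-step s s↗)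

module Carlitz (d : ℕ) where

  ValidBlock : ℕ × List ℕ → Set
  ValidBlock (D , g) = length g ≡ d × All (_≤ D) g

  ValidWord : List ℕ × List ℕ → Set
  ValidWord (τ , e) = τ ∈ perms d × length e ≡ suc d

  sortedPairs : List ℕ → List (ℕ × ℕ)
  sortedPairs g = sort (zip g (oneTo d))

  carlitz : ℕ × List ℕ → List ℕ × List ℕ
  carlitz (D , g) = let s = sortedPairs g in map proj₂ s , gaps D (map proj₂ s) (map proj₁ s)

  carlitz⁻¹ : List ℕ × List ℕ → ℕ × List ℕ
  carlitz⁻¹ (τ , e) = top τ e , map (λ i → valueAt i (zip (heights τ e) τ)) (oneTo d)

  module _ {D : ℕ} {g : List ℕ} (valid : ValidBlock (D , g)) where

    private
      length-g : length g ≡ d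
      length-g = proj₁ valid
      g≤D : All (_≤ D) g
      g≤D = proj₂ valid
      s : List (ℕ × ℕ)
      s = sortedPairs g
      τ : List ℕ
      τ = map proj₂ s
      λs : List ℕ
      λs = map proj₁ s
      s↭ : s ↭ zip g (oneTo d)
      s↭ = sort-↭ _
      length-g≡ : length g ≡ length (oneTo d)
      length-g≡ = trans length-g (sym (length-oneTo d))
      τ↭ : τ ↭ oneTo d
      τ↭ = ↭-trans (↭.map⁺ proj₂ s↭) (↭-reflexive (map-proj₂-zip g (oneTo d) length-g≡))
      !τ : Unique τ
      !τ = Unique-resp-↭ (↭-sym τ↭) (oneTo-unique d)
      length-λs : length λs ≡ length τ
      length-λs = trans (List.length-map proj₁ s) (sym (List.length-map proj₂ s))
      value≤D : ∀ {x} → x ∈ s → proj₁ x ≤ D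
      value≤D x∈ = All.lookup g≤D (proj₁ (∈-zip⁻ g (oneTo d) (↭.∈-resp-↭ s↭ x∈)))
      below : HeadBelow D s
      below with s | value≤D
      ... | []    | _     = tt
      ... | _ ∷ _ | bound = bound (here refl)

    carlitz-valid : ValidWord (carlitz (D , g))
    carlitz-valid = ∈-perms⁺ d τ↭ ,
      trans (length-gaps D τ λs length-λs) (cong suc (trans (↭.↭-length τ↭) (length-oneTo d)))

    carlitz⁻¹∘carlitz : carlitz⁻¹ (carlitz (D , g)) ≡ (D , g)
    carlitz⁻¹∘carlitz = cong₂ _,_ (top-gaps D s (sort-↗ _) below) (begin
      map (λ i → valueAt i (zip (heights τ (gaps D τ λs)) τ)) (oneTo d)
        ≡⟨ cong (λ hs → map (λ i → valueAt i (zip hs τ)) (oneTo d)) (heights-gaps D s (sort-↗ _) below) ⟩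
      map (λ i → valueAt i (zip λs τ)) (oneTo d)              ≡⟨ cong (λ s′ → map (λ i → valueAt i s′) (oneTo d)) (zip-map-proj s) ⟩
      map (λ i → valueAt i s) (oneTo d)                       ≡⟨ cong (map _) (map-proj₂-zip g (oneTo d) length-g≡) ⟨
      map (λ i → valueAt i s) (map proj₂ (zip g (oneTo d)))   ≡⟨ List.map-∘ (zip g (oneTo d)) ⟨
      map (λ x → valueAt (proj₂ x) s) (zip g (oneTo d))       ≡⟨ List.map-cong-local (All.tabulate λ x∈ →
                                                                   valueAt-∈ s !τ (↭.∈-resp-↭ (↭-sym s↭) x∈)) ⟩
      map proj₁ (zip g (oneTo d))                             ≡⟨ map-proj₁-zip g (oneTo d) length-g≡ ⟩
      g                                                       ∎)
      where open ≡-Reasoning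

  module _ {τ e : List ℕ} (valid : ValidWord (τ , e)) where

    private
      τ∈ : τ ∈ perms d
      τ∈ = proj₁ valid
      length-e : length e ≡ suc d
      length-e = proj₂ valid
      τ↭ : τ ↭ oneTo d
      τ↭ = ∈-perms⁻ d τ∈
      !τ : Unique τ
      !τ = Unique-resp-↭ (↭-sym τ↭) (oneTo-unique d)
      length-τ : length τ ≡ d
      length-τ = trans (↭.↭-length τ↭) (length-oneTo d)
      length-e′ : length e ≡ suc (length τ)
      length-e′ = trans length-e (cong suc (sym length-τ))
      λs : List ℕ
      λs = heights τ e
      length-λs : length λs ≡ length τ
      length-λs = length-heights τ e length-e′
      s₀ : List (ℕ × ℕ)
      s₀ = zip λs τ
      !s₀ : Unique (map proj₂ s₀)
      !s₀ = subst Unique (sym (map-proj₂-zip λs τ length-λs)) !τ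
      value : ℕ → ℕ
      value i = valueAt i s₀
      g : List ℕ
      g = map value (oneTo d)
      length-g : length g ≡ d
      length-g = trans (List.length-map value (oneTo d)) (length-oneTo d)
      pairs↭ : zip g (oneTo d) ↭ s₀
      pairs↭ = begin
        zip g (oneTo d)                                 ≡⟨ zip-map-self value (oneTo d) ⟩
        map (λ i → (value i , i)) (oneTo d)             ↭⟨ ↭.map⁺ _ (↭-sym τ↭) ⟩
        map (λ i → (value i , i)) τ                     ≡⟨ cong (map _) (map-proj₂-zip λs τ length-λs) ⟨
        map (λ i → (value i , i)) (map proj₂ s₀)        ≡⟨ List.map-∘ s₀ ⟨
        map (λ x → (value (proj₂ x) , proj₂ x)) s₀      ≡⟨ List.map-id-local (All.tabulate λ x∈ → cong (_, _) (valueAt-∈ s₀ !s₀ x∈)) ⟩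
        s₀                                              ∎
        where open PermutationReasoning
      sorted≡ : sortedPairs g ≡ s₀
      sorted≡ = sorted-↭⇒≡ (sort-↗ _) (heights-sorted τ e length-e′) (↭-trans (sort-↭ _) pairs↭)
      g↭λs : g ↭ λs
      g↭λs = ↭-trans (↭-reflexive (sym (map-proj₁-zip g (oneTo d) (trans length-g (sym (length-oneTo d))))))
                     (↭-trans (↭.map⁺ proj₁ pairs↭) (↭-reflexive (map-proj₁-zip λs τ length-λs)))

    carlitz⁻¹-valid : ValidBlock (carlitz⁻¹ (τ , e))
    carlitz⁻¹-valid = length-g , All.tabulate λ v∈ →
      let i , _ , v≡ = ∈-map⁻ value v∈ in
      subst (_≤ top τ e) (sym v≡) (valueAt-≤ s₀ i _ values≤top)
      where
      values≤top : All (_≤ top τ e) (map proj₁ s₀)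
      values≤top = subst (All (_≤ top τ e)) (sym (map-proj₁-zip λs τ length-λs)) (heights-≤top τ e length-e′)

    carlitz∘carlitz⁻¹ : carlitz (carlitz⁻¹ (τ , e)) ≡ (τ , e)
    carlitz∘carlitz⁻¹ = begin
      map proj₂ (sortedPairs g) , gaps (top τ e) (map proj₂ (sortedPairs g)) (map proj₁ (sortedPairs g))
        ≡⟨ cong (λ s → map proj₂ s , gaps (top τ e) (map proj₂ s) (map proj₁ s)) sorted≡ ⟩
      map proj₂ s₀ , gaps (top τ e) (map proj₂ s₀) (map proj₁ s₀)
        ≡⟨ cong₂ (λ τ′ λs′ → τ′ , gaps (top τ e) τ′ λs′)
                 (map-proj₂-zip λs τ length-λs) (map-proj₁-zip λs τ length-λs) ⟩
      τ , gaps (top τ e) τ λs                                      ≡⟨ cong (τ ,_) (gaps-heights τ e length-e′) ⟩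
      τ , e                                                        ∎
      where open ≡-Reasoning

    carlitz⁻¹-top : proj₁ (carlitz⁻¹ (τ , e)) ≡ des τ + sum e
    carlitz⁻¹-top = top≡des+sum τ e length-e′

    carlitz⁻¹-sum : sum (proj₂ (carlitz⁻¹ (τ , e))) ≡ maj τ + firstMoment e
    carlitz⁻¹-sum = trans (sum-↭ g↭λs) (sum-heights τ e length-e′)

  carlitz-correspondence : Correspondence ValidBlock ValidWord
  carlitz-correspondence = record
    { to      = carlitz
    ; from    = carlitz⁻¹
    ; to-V    = carlitz-valid
    ; from-U  = carlitz⁻¹-valid
    ; from∘to = carlitz⁻¹∘carlitz
    ; to∘from = carlitz∘carlitz⁻¹
    }

-- Diamonds as stacks of blocks

head₀ : List ℕ → ℕ
head₀ []      = 0
head₀ (x ∷ _) = x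

at-++ˡ : ∀ fs r i → 1 ≤ i → i ≤ length fs → at (fs ++ r) i ≡ at fs i
at-++ˡ (f ∷ fs) r (suc zero)    _ _         = refl
at-++ˡ (f ∷ fs) r (suc (suc i)) _ (s≤s i≤) = at-++ˡ fs r (suc i) (s≤s z≤n) i≤

at-++ʳ : ∀ fs r k → at (fs ++ r) (length fs + suc k) ≡ at r (suc k)
at-++ʳ []       r k = refl
at-++ʳ (f ∷ fs) r k = begin
  at (f ∷ fs ++ r) (suc (length fs + suc k))  ≡⟨ cong (at (f ∷ fs ++ r) ∘ suc) (+-suc (length fs) k) ⟩
  at (fs ++ r) (suc (length fs + k))          ≡⟨ cong (at (fs ++ r)) (+-suc (length fs) k) ⟨
  at (fs ++ r) (length fs + suc k)            ≡⟨ at-++ʳ fs r k ⟩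
  at r (suc k)                                ∎
  where open ≡-Reasoning

allB-cong : ∀ {A : Set} {P Q : A → Bool} xs → (∀ {x} → x ∈ xs → P x ≡ Q x) → allB P xs ≡ allB Q xs
allB-cong []       P≗Q = refl
allB-cong (x ∷ xs) P≗Q = cong₂ _∧_ (P≗Q (here refl)) (allB-cong xs (P≗Q ∘ there))

allB-map : ∀ {A B : Set} (P : B → Bool) (f : A → B) xs → allB P (map f xs) ≡ allB (P ∘ f) xs
allB-map P f []       = refl
allB-map P f (x ∷ xs) = cong (P (f x) ∧_) (allB-map P f xs)

allB-at : ∀ (P : ℕ → Bool) fs → allB (P ∘ at fs) (oneTo (length fs)) ≡ allB P fs
allB-at P []       = refl
allB-at P (f ∷ fs) = cong (P f ∧_) (begin
  allB (P ∘ at (f ∷ fs)) (map suc (applyUpTo suc n)) ≡⟨ cong (allB (P ∘ at (f ∷ fs)) ∘ map suc) (List.map-upTo suc n) ⟨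
  allB (P ∘ at (f ∷ fs)) (map suc (map suc (upTo n))) ≡⟨ allB-map _ suc (map suc (upTo n)) ⟩
  allB (P ∘ at (f ∷ fs) ∘ suc) (map suc (upTo n))    ≡⟨ allB-map _ suc (upTo n) ⟩
  allB (P ∘ at fs ∘ suc) (upTo n)                    ≡⟨ allB-map (P ∘ at fs) suc (upTo n) ⟨
  allB (P ∘ at fs) (oneTo n)                         ≡⟨ allB-at P fs ⟩
  allB P fs                                          ∎)
  where
  open ≡-Reasoning
  n : ℕ
  n = length fs

+-≡ᵇ : ∀ k x y → (k + x ≡ᵇ k + y) ≡ (x ≡ᵇ y)
+-≡ᵇ zero    x y = refl
+-≡ᵇ (suc k) x y = +-≡ᵇ k x y

module Diamonds (d : ℕ) where

  isLink-1 : isLink d 1 ≡ true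
  isLink-1 = Equivalence.to T-≡ (≡⇒≡ᵇ (1 % suc d) _ refl)

  isLink-periodic : ∀ j → isLink d (suc d + j) ≡ isLink d j
  isLink-periodic j = cong (_≡ᵇ 1 % suc d) (trans (cong (_% suc d) (+-comm (suc d) j)) ([m+n]%n≡m%n j (suc d)))

  isLink-fold : ∀ j → 1 ≤ j → j ≤ d → isLink d (suc j) ≡ false
  isLink-fold (suc j) _ j<d with m≤n⇒m<n∨m≡n j<d
  ... | inj₁ j+1<d = cong₂ _≡ᵇ_ (m<n⇒m%n≡m (s≤s j+1<d)) 1%d
    where
    1%d : 1 % suc d ≡ 1
    1%d = m<n⇒m%n≡m (s≤s (≤-trans (s≤s z≤n) j<d))
  ... | inj₂ refl  = cong₂ _≡ᵇ_ (n%n≡0 (suc d)) (m<n⇒m%n≡m {n = suc d} (s≤s (s≤s z≤n)))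

  linkSum-block : ∀ L fs r → length fs ≡ d → linkSum d (L ∷ fs ++ r) ≡ L + linkSum d r
  linkSum-block L fs r refl = begin
    linkSum d (L ∷ fs ++ r)
      ≡⟨ sum-at-filter (isLink d) (L ∷ fs ++ r) ⟩
    (if isLink d 1 then L else 0) + selectSum (isLink d ∘ suc) (fs ++ r)
      ≡⟨ cong₂ _+_ (cong (if_then L else 0) isLink-1) (selectSum-++ _ fs r) ⟩
    L + (selectSum (isLink d ∘ suc) fs + selectSum (λ j → isLink d (suc d + j)) r)
      ≡⟨ cong (L +_) (cong₂ _+_ (selectSum-none _ fs isLink-fold) (selectSum-cong r isLink-periodic)) ⟩
    L + selectSum (isLink d) r
      ≡⟨ cong (L +_) (sum-at-filter (isLink d) r) ⟨
    L + linkSum d r ∎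
    where open ≡-Reasoning

  foldSum-block : ∀ L fs r → length fs ≡ d → foldSum d (L ∷ fs ++ r) ≡ sum fs + foldSum d r
  foldSum-block L fs r refl = begin
    foldSum d (L ∷ fs ++ r)
      ≡⟨ sum-at-filter (not ∘ isLink d) (L ∷ fs ++ r) ⟩
    (if not (isLink d 1) then L else 0) + selectSum (not ∘ isLink d ∘ suc) (fs ++ r)
      ≡⟨ cong₂ _+_ (cong (λ b → if not b then L else 0) isLink-1) (selectSum-++ _ fs r) ⟩
    selectSum (not ∘ isLink d ∘ suc) fs + selectSum (λ j → not (isLink d (suc d + j))) r
      ≡⟨ cong₂ _+_ (selectSum-all _ fs (λ j 1≤j j≤d → cong not (isLink-fold j 1≤j j≤d)))
                   (selectSum-cong r (cong not ∘ isLink-periodic)) ⟩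
    sum fs + selectSum (not ∘ isLink d) r
      ≡⟨ cong (sum fs +_) (sum-at-filter (not ∘ isLink d) r) ⟨
    sum fs + foldSum d r ∎
    where open ≡-Reasoning

  linkSum-[_] : ∀ m → linkSum d (m ∷ []) ≡ m
  linkSum-[ m ] =
    trans (sum-at-filter (isLink d) (m ∷ [])) (trans (cong (λ b → (if b then m else 0) + 0) isLink-1) (+-identityʳ m))

  foldSum-[_] : ∀ m → foldSum d (m ∷ []) ≡ 0
  foldSum-[ m ] = trans (sum-at-filter (not ∘ isLink d) (m ∷ [])) (cong (λ b → (if not b then m else 0) + 0) isLink-1)

  rowCondition : List ℕ → ℕ → ℕ → Bool
  rowCondition a n i =
    (at a (n * suc d + 1 + i) ≤ᵇ at a (n * suc d + 1)) ∧ (at a (suc n * suc d + 1) ≤ᵇ at a (n * suc d + 1 + i))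

  -- isDiamond d M a is definitionally (length a ≡ᵇ len d M) ∧ rowsOK M a.
  rowsOK : ℕ → List ℕ → Bool
  rowsOK M a = allB (λ n → allB (rowCondition a n) (oneTo d)) (upTo M)

  between : ℕ → ℕ → ℕ → Bool
  between t L f = (f ≤ᵇ L) ∧ (t ≤ᵇ f)

  T-between⁻ : ∀ {t L f} → T (between t L f) → f ≤ L × t ≤ f
  T-between⁻ {t} {L} {f} b = let f≤L , t≤f = Equivalence.to T-∧ b in ≤ᵇ⇒≤ f L f≤L , ≤ᵇ⇒≤ t f t≤f

  T-between⁺ : ∀ {t L f} → f ≤ L × t ≤ f → T (between t L f)
  T-between⁺ (f≤L , t≤f) = Equivalence.from T-∧ (≤⇒≤ᵇ f≤L , ≤⇒≤ᵇ t≤f)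

  at-nextBlock : ∀ L fs r Y → length fs ≡ d → 1 ≤ Y → at (L ∷ fs ++ r) (suc d + Y) ≡ at r Y
  at-nextBlock L fs r (suc y) refl _ =
    trans (at-∷ (length fs + suc y) (subst (1 ≤_) (sym (+-suc (length fs) y)) (s≤s z≤n))) (at-++ʳ fs r y)
    where
    at-∷ : ∀ k → 1 ≤ k → at (L ∷ fs ++ r) (suc k) ≡ at (fs ++ r) k
    at-∷ (suc k) _ = refl

  module _ (M L : ℕ) (fs r : List ℕ) (length-fs : length fs ≡ d) where

    private
      a : List ℕ
      a = L ∷ fs ++ r

    length-block : (length a ≡ᵇ len d (suc M)) ≡ (length r ≡ᵇ len d M)
    length-block = begin
      (length (fs ++ r) ≡ᵇ d + M * suc d + 1)
        ≡⟨ cong₂ _≡ᵇ_ (trans (List.length-++ fs {r}) (cong (_+ length r) length-fs)) (+-assoc d (M * suc d) 1) ⟩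
      (d + length r ≡ᵇ d + (M * suc d + 1))     ≡⟨ +-≡ᵇ d (length r) _ ⟩
      (length r ≡ᵇ len d M)                     ∎
      where open ≡-Reasoning

    firstRow : allB (rowCondition a 0) (oneTo d) ≡ allB (between (head₀ r) L) fs
    firstRow = begin
      allB (rowCondition a 0) (oneTo d)                  ≡⟨ allB-cong (oneTo d) fold ⟩
      allB (between (head₀ r) L ∘ at fs) (oneTo d)       ≡⟨ cong (allB _ ∘ oneTo) length-fs ⟨
      allB (between (head₀ r) L ∘ at fs) (oneTo (length fs)) ≡⟨ allB-at _ fs ⟩
      allB (between (head₀ r) L) fs                      ∎
      where
      open ≡-Reasoning
      link : at a (1 * suc d + 1) ≡ head₀ r
      link = trans (cong (at a) (cong (_+ 1) (+-identityʳ (suc d))))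
                   (trans (at-nextBlock L fs r 1 length-fs (s≤s z≤n)) (head₀-at r))
        where
        head₀-at : ∀ r → at r 1 ≡ head₀ r
        head₀-at []      = refl
        head₀-at (_ ∷ _) = refl
      fold : ∀ {i} → i ∈ oneTo d → rowCondition a 0 i ≡ between (head₀ r) L (at fs i)
      fold {zero}  i∈ with () ← proj₁ (∈-oneTo⁻ i∈)
      fold {suc i} i∈ = cong₂ (λ x y → (x ≤ᵇ L) ∧ (y ≤ᵇ x))
        (at-++ˡ fs r (suc i) (s≤s z≤n) (≤-trans (proj₂ (∈-oneTo⁻ i∈)) (≤-reflexive (sym length-fs)))) link

    laterRows : allB (λ n → allB (rowCondition a n) (oneTo d)) (applyUpTo suc M) ≡ rowsOK M r
    laterRows = begin
      allB (λ n → allB (rowCondition a n) (oneTo d)) (applyUpTo suc M)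
        ≡⟨ cong (allB (λ n → allB (rowCondition a n) (oneTo d))) (List.map-upTo suc M) ⟨
      allB (λ n → allB (rowCondition a n) (oneTo d)) (map suc (upTo M))
        ≡⟨ allB-map _ suc (upTo M) ⟩
      allB (λ n → allB (rowCondition a (suc n)) (oneTo d)) (upTo M)
        ≡⟨ allB-cong (upTo M) (λ {n} _ → allB-cong (oneTo d) (λ {i} _ → nextRow n i)) ⟩
      rowsOK M r ∎
      where
      open ≡-Reasoning
      nextRow : ∀ n i → rowCondition a (suc n) i ≡ rowCondition r n i
      nextRow n i = cong₂ _∧_ (cong₂ _≤ᵇ_ fold link) (cong₂ _≤ᵇ_ link′ fold)
        where
        X : ℕ
        X = n * suc d
        fold : at a (suc n * suc d + 1 + i) ≡ at r (X + 1 + i)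
        fold = trans (cong (at a) (trans (cong (_+ i) (+-assoc (suc d) X 1)) (+-assoc (suc d) (X + 1) i)))
                     (at-nextBlock L fs r _ length-fs (≤-trans (m≤n+m 1 X) (m≤m+n _ i)))
        link : at a (suc n * suc d + 1) ≡ at r (X + 1)
        link = trans (cong (at a) (+-assoc (suc d) X 1)) (at-nextBlock L fs r _ length-fs (m≤n+m 1 X))
        link′ : at a (suc (suc n) * suc d + 1) ≡ at r (suc n * suc d + 1)
        link′ = trans (cong (at a) (+-assoc (suc d) (suc n * suc d) 1)) (at-nextBlock L fs r _ length-fs (m≤n+m 1 (suc n * suc d)))

    isDiamond-∷ : isDiamond d (suc M) a ≡ (length r ≡ᵇ len d M) ∧ (allB (between (head₀ r) L) fs ∧ rowsOK M r)
    isDiamond-∷ = cong₂ _∧_ length-block (cong₂ _∧_ firstRow laterRows)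

    isDiamond-∷⁻ : T (isDiamond d (suc M) a) → All (λ f → f ≤ L × head₀ r ≤ f) fs × T (isDiamond d M r)
    isDiamond-∷⁻ t =
      let length-ok , rest = Equivalence.to (T-∧ {length r ≡ᵇ len d M}) (subst T isDiamond-∷ t)
          fs-ok , rows-ok  = Equivalence.to (T-∧ {allB (between (head₀ r) L) fs}) rest
      in All.map T-between⁻ (allB⁻ _ fs fs-ok) , Equivalence.from (T-∧ {length r ≡ᵇ len d M}) (length-ok , rows-ok)

    isDiamond-∷⁺ : All (λ f → f ≤ L × head₀ r ≤ f) fs → T (isDiamond d M r) → T (isDiamond d (suc M) a)
    isDiamond-∷⁺ fs-ok t =
      let length-ok , rows-ok = Equivalence.to (T-∧ {length r ≡ᵇ len d M}) t
      in subst T (sym isDiamond-∷)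
           (Equivalence.from (T-∧ {length r ≡ᵇ len d M})
             (length-ok , Equivalence.from (T-∧ {allB (between (head₀ r) L) fs}) (allB⁺ _ fs (All.map T-between⁺ fs-ok) , rows-ok)))

take-++ : ∀ {A : Set} n (xs ys : List A) → length xs ≡ n → take n (xs ++ ys) ≡ xs
take-++ _ []       ys refl = refl
take-++ _ (x ∷ xs) ys refl = cong (x ∷_) (take-++ _ xs ys refl)

drop-++ : ∀ {A : Set} n (xs ys : List A) → length xs ≡ n → drop n (xs ++ ys) ≡ ys
drop-++ _ []       ys refl = refl
drop-++ _ (x ∷ xs) ys refl = drop-++ _ xs ys refl

sum-map-+ : ∀ t xs → sum (map (t +_) xs) ≡ length xs * t + sum xs
sum-map-+ t []       = refl
sum-map-+ t (x ∷ xs) rewrite sum-map-+ t xs =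
  solve 4 (λ t x n s → t :+ x :+ (n :+ s) := t :+ n :+ (x :+ s)) refl t x (length xs * t) (sum xs)

module BlockDecomposition (d : ℕ) where

  open Diamonds d
  open Carlitz d using (ValidBlock)

  Block : Set
  Block = ℕ × List ℕ

  -- m is the bottom link; a block (D , g) raises its top link by D and its folds by g over the link below it.
  diamond : ℕ → List Block → List ℕ
  diamond m []             = m ∷ []
  diamond m ((D , g) ∷ bs) = let t = head₀ (diamond m bs) in (t + D) ∷ map (t +_) g ++ diamond m bs

  blocksOf : ℕ → List ℕ → ℕ × List Block
  blocksOf zero    a       = head₀ a , []
  blocksOf (suc M) []      = 0 , []
  blocksOf (suc M) (L ∷ a) =
    let r = drop d a ; t = head₀ r in
    proj₁ (blocksOf M r) , (L ∸ t , map (_∸ t) (take d a)) ∷ proj₂ (blocksOf M r)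

  diamond-valid : ∀ M m bs → length bs ≡ M → All ValidBlock bs → T (isDiamond d M (diamond m bs))
  diamond-valid zero    m []             _ _ = tt
  diamond-valid (suc M) m ((D , g) ∷ bs) l ((length-g , g≤D) ∷ valid) =
    isDiamond-∷⁺ M (t + D) (map (t +_) g) r (trans (List.length-map _ g) length-g)
      (All.map⁺ (All.map (λ {x} x≤D → +-monoʳ-≤ t x≤D , m≤m+n t x) g≤D))
      (diamond-valid M m bs (suc-injective l) valid)
    where
    r : List ℕ
    r = diamond m bs
    t : ℕ
    t = head₀ r

  isDiamond-split : ∀ M L a → T (isDiamond d (suc M) (L ∷ a)) →
                    length (take d a) ≡ d × All (λ f → f ≤ L × head₀ (drop d a) ≤ f) (take d a) × T (isDiamond d M (drop d a))
  isDiamond-split M L a t =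
    length-take , isDiamond-∷⁻ M L (take d a) (drop d a) length-take
                    (subst (λ a′ → T (isDiamond d (suc M) (L ∷ a′))) (sym (List.take++drop≡id d a)) t)
    where
    length-a : length a ≡ d + M * suc d + 1
    length-a = suc-injective (length-isDiamond d (suc M) (L ∷ a) t)
    length-take : length (take d a) ≡ d
    length-take = trans (List.length-take d a)
      (trans (cong (d ⊓_) length-a) (m≤n⇒m⊓n≡m (≤-trans (m≤m+n d (M * suc d)) (m≤m+n _ 1))))

  blocksOf-valid : ∀ M a → T (isDiamond d M a) → Stack M ValidBlock (blocksOf M a)
  blocksOf-valid zero    a       _ = refl , []
  blocksOf-valid (suc M) (L ∷ a) t =
    cong suc (proj₁ ih) ,
    (trans (List.length-map _ (take d a)) length-take ,
     All.map⁺ (All.map (λ (f≤L , _) → ∸-monoˡ-≤ (head₀ (drop d a)) f≤L) fs-ok))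
    ∷ proj₂ ih
    where
    length-take : length (take d a) ≡ d
    length-take = proj₁ (isDiamond-split M L a t)
    fs-ok : All (λ f → f ≤ L × head₀ (drop d a) ≤ f) (take d a)
    fs-ok = proj₁ (proj₂ (isDiamond-split M L a t))
    ih : Stack M ValidBlock (blocksOf M (drop d a))
    ih = blocksOf-valid M (drop d a) (proj₂ (proj₂ (isDiamond-split M L a t)))

  -- The top link dominates the folds of its block only when there is at least one fold.
  diamond-blocksOf : 1 ≤ d → ∀ M a → T (isDiamond d M a) → uncurry diamond (blocksOf M a) ≡ a
  diamond-blocksOf _   zero    (x ∷ [])  _ = refl
  diamond-blocksOf 1≤d (suc M) (L ∷ a)   t = begin
    (head₀ E + (L ∸ t₀)) ∷ map (head₀ E +_) fs′ ++ E  ≡⟨ cong (λ E → (head₀ E + (L ∸ t₀)) ∷ map (head₀ E +_) fs′ ++ E) ih ⟩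
    (t₀ + (L ∸ t₀)) ∷ map (t₀ +_) fs′ ++ r            ≡⟨ cong₂ (λ x ys → x ∷ ys ++ r) (m+[n∸m]≡n t₀≤L) restore ⟩
    L ∷ take d a ++ drop d a                          ≡⟨ cong (L ∷_) (List.take++drop≡id d a) ⟩
    L ∷ a                                             ∎
    where
    open ≡-Reasoning
    r : List ℕ
    r = drop d a
    t₀ : ℕ
    t₀ = head₀ r
    fs′ : List ℕ
    fs′ = map (_∸ t₀) (take d a)
    E : List ℕ
    E = uncurry diamond (blocksOf M r)
    split : length (take d a) ≡ d × All (λ f → f ≤ L × t₀ ≤ f) (take d a) × T (isDiamond d M r)
    split = isDiamond-split M L a t
    fs-ok : All (λ f → f ≤ L × t₀ ≤ f) (take d a)
    fs-ok = proj₁ (proj₂ split)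
    ih : E ≡ r
    ih = diamond-blocksOf 1≤d M r (proj₂ (proj₂ split))
    t₀≤L : t₀ ≤ L
    t₀≤L with take d a | fs-ok | proj₁ split
    ... | []    | _                  | length≡d = contradiction (sym length≡d) (≢-nonZero⁻¹ _ ⦃ >-nonZero 1≤d ⦄)
    ... | _ ∷ _ | (f≤L , t₀≤f) ∷ _ | _        = ≤-trans t₀≤f f≤L
    restore : map (t₀ +_) fs′ ≡ take d a
    restore = trans (sym (List.map-∘ (take d a))) (List.map-id-local (All.map (λ (_ , t₀≤f) → m+[n∸m]≡n t₀≤f) fs-ok))

  blocksOf-diamond : ∀ M m bs → length bs ≡ M → All ValidBlock bs → blocksOf M (diamond m bs) ≡ (m , bs)
  blocksOf-diamond zero    m []             _ _ = refl
  blocksOf-diamond (suc M) m ((D , g) ∷ bs) l ((length-g , _) ∷ valid) = begin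
    unfold (take d X) (drop d X)                       ≡⟨ cong₂ unfold (take-++ d G r length-G) (drop-++ d G r length-G) ⟩
    unfold G r                                         ≡⟨ cong (λ (m′ , bs′) → m′ , ((t + D) ∸ t , map (_∸ t) G) ∷ bs′)
                                                               (blocksOf-diamond M m bs (suc-injective l) valid) ⟩
    m , ((t + D) ∸ t , map (_∸ t) G) ∷ bs              ≡⟨ cong₂ (λ D′ g′ → m , (D′ , g′) ∷ bs) (m+n∸m≡n t D) unshift ⟩
    m , (D , g) ∷ bs                                   ∎
    where
    open ≡-Reasoning
    r : List ℕ
    r = diamond m bs
    t : ℕ
    t = head₀ r
    G : List ℕ
    G = map (t +_) g
    X : List ℕ
    X = G ++ r
    length-G : length G ≡ d
    length-G = trans (List.length-map _ g) length-g
    unfold : List ℕ → List ℕ → ℕ × List Block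
    unfold fs r′ = proj₁ (blocksOf M r′) , ((t + D) ∸ head₀ r′ , map (_∸ head₀ r′) fs) ∷ proj₂ (blocksOf M r′)
    unshift : map (_∸ t) G ≡ g
    unshift = trans (sym (List.map-∘ g)) (trans (List.map-cong (m+n∸m≡n t) g) (List.map-id g))

  diamond-correspondence : 1 ≤ d → ∀ M → Correspondence (T ∘ isDiamond d M) (Stack M ValidBlock)
  diamond-correspondence 1≤d M = record
    { to      = blocksOf M
    ; from    = uncurry diamond
    ; to-V    = blocksOf-valid M _
    ; from-U  = λ (l , valid) → diamond-valid M _ _ l valid
    ; from∘to = diamond-blocksOf 1≤d M _
    ; to∘from = λ (l , valid) → blocksOf-diamond M _ _ l valid
    }

  diamondWeight : ℕ × List Block → ℕ × ℕ
  diamondWeight (m , bs) = foldSum d (diamond m bs) , linkSum d (diamond m bs)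

  -- A block with n blocks above it: its rise D lifts the d folds and the top link of each of them.
  blockWeight : ℕ → Block → ℕ × ℕ
  blockWeight n (D , g) = (n * d * D + sum g , suc n * D)

  head₀-diamond : ∀ m bs → head₀ (diamond m bs) ≡ m + sum (map proj₁ bs)
  head₀-diamond m []             = sym (+-identityʳ m)
  head₀-diamond m ((D , g) ∷ bs) rewrite head₀-diamond m bs =
    solve 3 (λ m s D → m :+ s :+ D := m :+ (D :+ s)) refl m (sum (map proj₁ bs)) D

  blockWeight-shift : ∀ ns bs → length ns ≡ length bs →
                      weightSum blockWeight (map suc ns) bs
                      ≡ weightSum blockWeight ns bs +² (d * sum (map proj₁ bs) , sum (map proj₁ bs))
  blockWeight-shift []       []             _ = cong₂ _,_ (sym (*-zeroʳ d)) refl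
  blockWeight-shift (n ∷ ns) ((D , g) ∷ bs) l =
    trans (cong (blockWeight (suc n) (D , g) +²_) (blockWeight-shift ns bs (suc-injective l)))
      (cong₂ _,_
        (solve 6 (λ n d D sg W S → (con 1 :+ n) :* d :* D :+ sg :+ (W :+ d :* S) := n :* d :* D :+ sg :+ W :+ d :* (D :+ S))
           refl n d D (sum g) (proj₁ W) (sum (map proj₁ bs)))
        (solve 4 (λ n D W S → (con 2 :+ n) :* D :+ (W :+ S) := (con 1 :+ n) :* D :+ W :+ (D :+ S))
           refl n D (proj₂ W) (sum (map proj₁ bs))))
    where W = weightSum blockWeight ns bs

  diamond-weight : ∀ m bs → All ValidBlock bs →
                   diamondWeight (m , bs) ≡ weightSum blockWeight (upTo (length bs)) bs +² (m * (length bs * d) , m * (length bs + 1))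
  diamond-weight m []             _ = cong₂ _,_ (trans foldSum-[ m ] (sym (*-zeroʳ m))) (trans linkSum-[ m ] (sym (*-identityʳ m)))
  diamond-weight m ((D , g) ∷ bs) ((length-g , _) ∷ valid) = begin
    foldSum d (t + D ∷ G ++ r) , linkSum d (t + D ∷ G ++ r)
      ≡⟨ cong₂ _,_ (foldSum-block _ G r length-G) (linkSum-block _ G r length-G) ⟩
    sum G + foldSum d r , t + D + linkSum d r
      ≡⟨ cong₂ (λ s w → s + proj₁ w , t + D + proj₂ w) (sum-map-+ t g) (diamond-weight m bs valid) ⟩
    length g * t + sum g + (proj₁ W + m * (L * d)) , t + D + (proj₂ W + m * (L + 1))
      ≡⟨ cong₂ (λ k t → k * t + sum g + (proj₁ W + m * (L * d)) , t + D + (proj₂ W + m * (L + 1))) length-g (head₀-diamond m bs) ⟩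
    d * (m + S) + sum g + (proj₁ W + m * (L * d)) , m + S + D + (proj₂ W + m * (L + 1))
      ≡⟨ cong₂ _,_
           (solve 7 (λ d m S D sg W L → d :* (m :+ S) :+ sg :+ (W :+ m :* (L :* d))
                                        := con 0 :* d :* D :+ sg :+ (W :+ d :* S) :+ m :* ((con 1 :+ L) :* d)) refl d m S D (sum g) (proj₁ W) L)
           (solve 5 (λ m S D W L → m :+ S :+ D :+ (W :+ m :* (L :+ con 1))
                                   := con 1 :* D :+ (W :+ S) :+ m :* ((con 1 :+ L) :+ con 1)) refl m S D (proj₂ W) L) ⟩
    blockWeight 0 (D , g) +² (W +² (d * S , S)) +² (m * (suc L * d) , m * (suc L + 1))
      ≡⟨ cong (λ w → blockWeight 0 (D , g) +² w +² (m * (suc L * d) , m * (suc L + 1)))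
              (sym (blockWeight-shift (upTo L) bs (List.length-upTo L))) ⟩
    blockWeight 0 (D , g) +² weightSum blockWeight (map suc (upTo L)) bs +² (m * (suc L * d) , m * (suc L + 1))
      ≡⟨ cong (λ ns → blockWeight 0 (D , g) +² weightSum blockWeight ns bs +² (m * (suc L * d) , m * (suc L + 1))) (List.map-upTo suc L) ⟩
    weightSum blockWeight (upTo (suc L)) ((D , g) ∷ bs) +² (m * (suc L * d) , m * (suc L + 1)) ∎
    where
    open ≡-Reasoning
    L : ℕ
    L = length bs
    S : ℕ
    S = sum (map proj₁ bs)
    r : List ℕ
    r = diamond m bs
    t : ℕ
    t = head₀ r
    G : List ℕ
    G = map (t +_) g
    length-G : length G ≡ d
    length-G = trans (List.length-map _ g) length-g
    W : ℕ × ℕ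
    W = weightSum blockWeight (upTo L) bs
-- The right-hand side

weightSum-reverse : ∀ c n b L e → c ≡ b + L → length e ≡ suc L →
                    weightSum (λ j k → (k * (c ∸ j) , k * n)) (upTo (suc L)) (reverse e) ≡ (b * sum e + firstMoment e , sum e * n)
weightSum-reverse c n b zero    (x ∷ []) refl _ = cong₂ _,_
  (solve 2 (λ x b → x :* (b :+ con 0) :+ con 0 := b :* (x :+ con 0) :+ con 0) refl x b)
  (solve 2 (λ x n → x :* n :+ con 0 := (x :+ con 0) :* n) refl x n)
weightSum-reverse c n b (suc L) (x ∷ xs) c≡ l = begin
  weightSum w (upTo (suc (suc L))) (reverse (x ∷ xs))
    ≡⟨ cong₂ (weightSum w) (sym (List.upTo-∷ʳ (suc L))) (List.unfold-reverse x xs) ⟩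
  weightSum w (upTo (suc L) ∷ʳ suc L) (reverse xs ∷ʳ x)
    ≡⟨ weightSum-∷ʳ w (upTo (suc L)) (reverse xs) (suc L) x
         (trans (List.length-upTo (suc L)) (sym (trans (List.length-reverse xs) (suc-injective l)))) ⟩
  weightSum w (upTo (suc L)) (reverse xs) +² w (suc L) x
    ≡⟨ cong₂ _+²_ (weightSum-reverse c n (suc b) L xs (trans c≡ (+-suc b L)) (suc-injective l))
                  (cong (λ c′ → (x * (c′ ∸ suc L) , x * n)) c≡) ⟩
  (suc b * sum xs + firstMoment xs , sum xs * n) +² (x * (b + suc L ∸ suc L) , x * n)
    ≡⟨ cong (λ k → (suc b * sum xs + firstMoment xs , sum xs * n) +² (x * k , x * n)) (m+n∸n≡m b (suc L)) ⟩
  (suc b * sum xs + firstMoment xs , sum xs * n) +² (x * b , x * n)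
    ≡⟨ cong₂ _,_ (solve 4 (λ b s w x → (con 1 :+ b) :* s :+ w :+ x :* b := b :* (x :+ s) :+ (w :+ s)) refl b (sum xs) (firstMoment xs) x)
                 (solve 3 (λ s n x → s :* n :+ x :* n := (x :+ s) :* n) refl (sum xs) n x) ⟩
  (b * sum (x ∷ xs) + firstMoment (x ∷ xs) , sum (x ∷ xs) * n) ∎
  where
  open ≡-Reasoning
  w : ℕ → ℕ → ℕ × ℕ
  w j k = (k * (c ∸ j) , k * n)

module RightHandSide (d M : ℕ) where

  open Carlitz d
  open BlockDecomposition d

  eulerMahonianWeight : ℕ → List ℕ → ℕ × ℕ
  eulerMahonianWeight n τ = ((n ∸ 1) * d * des τ + 1 * maj τ , n * des τ + 0 * maj τ)

  inverseWeight : ℕ → List ℕ → ℕ × ℕ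
  inverseWeight n = weightSum (λ j k → (k * (n * d ∸ j) , k * n)) (upTo (suc d))

  -- The permutations τₙ, the exponent of 1/(1 - a^{Md} b^{M+1}), and the exponents kₙⱼ.
  Term : Set
  Term = (List (List ℕ) × ℕ) × List (List ℕ)

  ValidTerm : Term → Set
  ValidTerm ((τs , _) , kss) =
    (Pointwise (λ _ τ → τ ∈ perms d) (oneTo M) τs × ⊤) × Pointwise (λ _ → Pointwise (λ _ _ → ⊤) (upTo (suc d))) (oneTo M) kss

  termWeight : Term → ℕ × ℕ
  termWeight ((τs , k) , kss) =
    weightSum eulerMahonianWeight (oneTo M) τs +² (k * (M * d) , k * (M + 1)) +² weightSum inverseWeight (oneTo M) kss

  Enumeration-rhs : Enumeration (rhs d M) ValidTerm termWeight
  Enumeration-rhs = Enumeration-⊗ (Enumeration-⊗ eulerMahonian (Enumeration-inv1m (M * d) (M + 1) (m≤n+m 1 M))) inverses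
    where
    eulerMahonian : Enumeration (prodS (oneTo M) (λ n → EulerMahonianAt d ((n ∸ 1) * d) n 1 0))
                                (Pointwise (λ _ τ → τ ∈ perms d) (oneTo M)) (weightSum eulerMahonianWeight (oneTo M))
    eulerMahonian = Enumeration-prodS [] (oneTo M) λ {n} _ →
      Enumeration-sumOfMonomials (λ τ → (n ∸ 1) * d * des τ + 1 * maj τ) (λ τ → n * des τ + 0 * maj τ) (perms d) (perms-unique d)
    inverses : Enumeration (prodS (oneTo M) (λ n → prodS (upTo (suc d)) (λ j → inv1m (n * d ∸ j) n)))
                           (Pointwise (λ _ → Pointwise (λ _ _ → ⊤) (upTo (suc d))) (oneTo M)) (weightSum inverseWeight (oneTo M))
    inverses = Enumeration-prodS [] (oneTo M) λ {n} n∈ →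
      Enumeration-prodS 0 (upTo (suc d)) λ {j} _ → Enumeration-inv1m (n * d ∸ j) n (proj₁ (∈-oneTo⁻ n∈))

  toStack : Term → ℕ × List (List ℕ × List ℕ)
  toStack ((τs , k) , kss) = k , zip τs (map reverse kss)

  toTerm : ℕ × List (List ℕ × List ℕ) → Term
  toTerm (m , cs) = (map proj₁ cs , m) , map (reverse ∘ proj₂) cs

  private
    map-reverse-twice : ∀ {X : Set} (f : X → List ℕ) xs → map reverse (map (reverse ∘ f) xs) ≡ map f xs
    map-reverse-twice f xs = trans (sym (List.map-∘ xs)) (List.map-cong (List.reverse-involutive ∘ f) xs)

    length-reverse : ∀ {ks : List ℕ} → Pointwise (λ _ _ → ⊤) (upTo (suc d)) ks → length (reverse ks) ≡ suc d
    length-reverse {ks} ks-ok = trans (List.length-reverse ks) (trans (proj₁ (Pointwise-const⁻ ks-ok)) (List.length-upTo (suc d)))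

    reverse-valid : ∀ {e : List ℕ} → length e ≡ suc d → Pointwise (λ _ _ → ⊤) (upTo (suc d)) (reverse e)
    reverse-valid {e} length-e =
      Pointwise-const⁺ (trans (List.length-reverse e) (trans length-e (sym (List.length-upTo (suc d))))) (All.tabulate λ _ → tt)

  toStack-valid : ∀ {x} → ValidTerm x → Stack M ValidWord (toStack x)
  toStack-valid {(τs , _) , kss} ((τs-ok , _) , kss-ok) =
    length-zip {xs = τs} {map reverse kss} (trans length-τs (length-oneTo M))
               (trans (List.length-map reverse kss) (trans length-kss (length-oneTo M))) ,
    All-zip⁺ τs∈ (All.map⁺ (All.map length-reverse kss∈))
    where
    length-τs : length τs ≡ length (oneTo M)
    length-τs = proj₁ (Pointwise-const⁻ τs-ok)
    τs∈ : All (_∈ perms d) τs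
    τs∈ = proj₂ (Pointwise-const⁻ τs-ok)
    length-kss : length kss ≡ length (oneTo M)
    length-kss = proj₁ (Pointwise-const⁻ kss-ok)
    kss∈ : All (Pointwise (λ _ _ → ⊤) (upTo (suc d))) kss
    kss∈ = proj₂ (Pointwise-const⁻ kss-ok)

  toTerm-valid : ∀ {c} → Stack M ValidWord c → ValidTerm (toTerm c)
  toTerm-valid {_ , cs} (length-cs , valid) =
    (Pointwise-const⁺ (length≡ proj₁) (All.map⁺ (All.map proj₁ valid)) , tt) ,
    Pointwise-const⁺ (length≡ (reverse ∘ proj₂)) (All.map⁺ (All.map (λ {(_ , e)} (_ , length-e) → reverse-valid {e} length-e) valid))
    where
    length≡ : ∀ {X : Set} (f : List ℕ × List ℕ → X) → length (map f cs) ≡ length (oneTo M)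
    length≡ f = trans (List.length-map f cs) (trans length-cs (sym (length-oneTo M)))

  toTerm∘toStack : ∀ {x} → ValidTerm x → toTerm (toStack x) ≡ x
  toTerm∘toStack {(τs , k) , kss} ((τs-ok , _) , kss-ok) =
    cong₂ (λ τs′ kss′ → (τs′ , k) , kss′) (map-proj₁-zip τs (map reverse kss) same-length) (begin
      map (reverse ∘ proj₂) (zip τs (map reverse kss))   ≡⟨ List.map-∘ _ ⟩
      map reverse (map proj₂ (zip τs (map reverse kss))) ≡⟨ cong (map reverse) (map-proj₂-zip τs (map reverse kss) same-length) ⟩
      map reverse (map reverse kss)                      ≡⟨ map-reverse-twice (λ ks → ks) kss ⟩
      map (λ ks → ks) kss                                ≡⟨ List.map-id kss ⟩
      kss                                                ∎)
    where
    open ≡-Reasoning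
    same-length : length τs ≡ length (map reverse kss)
    same-length = trans (proj₁ (Pointwise-const⁻ τs-ok))
                        (sym (trans (List.length-map reverse kss) (proj₁ (Pointwise-const⁻ kss-ok))))

  toStack∘toTerm : ∀ c → toStack (toTerm c) ≡ c
  toStack∘toTerm (m , cs) = cong (m ,_) (trans (cong (zip (map proj₁ cs)) (map-reverse-twice proj₂ cs)) (zip-map-proj cs))

  -- The exponent kₙⱼ of 1/(1 - a^{nd-j} b^n) is the gap e_{d-j} of the n-th block.
  term-correspondence : Correspondence ValidTerm (Stack M ValidWord)
  term-correspondence = record
    { to      = toStack
    ; from    = toTerm
    ; to-V    = λ {x} → toStack-valid {x}
    ; from-U  = λ {c} → toTerm-valid {c}
    ; from∘to = λ {x} → toTerm∘toStack {x}
    ; to∘from = λ {c} _ → toStack∘toTerm c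
    }

  termWeight-block : ∀ n {c} → ValidWord c →
                     eulerMahonianWeight (suc n) (proj₁ c) +² inverseWeight (suc n) (reverse (proj₂ c)) ≡ blockWeight n (carlitz⁻¹ c)
  termWeight-block n {τ , e} valid@(_ , length-e) = begin
    eulerMahonianWeight (suc n) τ +² inverseWeight (suc n) (reverse e)
      ≡⟨ cong (eulerMahonianWeight (suc n) τ +²_) (weightSum-reverse (suc n * d) (suc n) (n * d) d e (+-comm d (n * d)) length-e) ⟩
    (n * d * des τ + 1 * maj τ , suc n * des τ + 0 * maj τ) +² (n * d * sum e + firstMoment e , sum e * suc n)
      ≡⟨ cong₂ _,_ (solve 5 (λ nd δ μ σ φ → nd :* δ :+ con 1 :* μ :+ (nd :* σ :+ φ) := nd :* (δ :+ σ) :+ (μ :+ φ))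
                              refl (n * d) (des τ) (maj τ) (sum e) (firstMoment e))
                   (solve 4 (λ n δ μ σ → (con 1 :+ n) :* δ :+ con 0 :* μ :+ σ :* (con 1 :+ n) := (con 1 :+ n) :* (δ :+ σ))
                              refl n (des τ) (maj τ) (sum e)) ⟩
    (n * d * (des τ + sum e) + (maj τ + firstMoment e) , suc n * (des τ + sum e))
      ≡⟨ cong₂ (λ D s → (n * d * D + s , suc n * D)) (carlitz⁻¹-top {τ} {e} valid) (carlitz⁻¹-sum {τ} {e} valid) ⟨
    blockWeight n (carlitz⁻¹ (τ , e)) ∎
    where open ≡-Reasoning

  termWeight≡diamondWeight : ∀ {m cs} → Stack M ValidWord (m , cs) →
                             termWeight (toTerm (m , cs)) ≡ diamondWeight (m , map carlitz⁻¹ cs)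
  termWeight≡diamondWeight {m} {cs} (refl , valid) = begin
    E +² bottom +² I                                                        ≡⟨ +²-swapʳ E bottom I ⟩
    E +² I +² bottom                                                        ≡⟨ cong (_+² bottom) blocks ⟩
    weightSum blockWeight (upTo L) (map carlitz⁻¹ cs) +² bottom
      ≡⟨ cong (λ k → weightSum blockWeight (upTo k) (map carlitz⁻¹ cs) +² (m * (k * d) , m * (k + 1))) (List.length-map carlitz⁻¹ cs) ⟨
    weightSum blockWeight (upTo L′) (map carlitz⁻¹ cs) +² (m * (L′ * d) , m * (L′ + 1))
      ≡⟨ diamond-weight m (map carlitz⁻¹ cs) (All.map⁺ (All.map (λ {c} → carlitz⁻¹-valid {proj₁ c} {proj₂ c}) valid)) ⟨
    diamondWeight (m , map carlitz⁻¹ cs)                                    ∎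
    where
    open ≡-Reasoning
    L : ℕ
    L = length cs
    L′ : ℕ
    L′ = length (map carlitz⁻¹ cs)
    E : ℕ × ℕ
    E = weightSum eulerMahonianWeight (oneTo L) (map proj₁ cs)
    I : ℕ × ℕ
    I = weightSum inverseWeight (oneTo L) (map (reverse ∘ proj₂) cs)
    bottom : ℕ × ℕ
    bottom = (m * (L * d) , m * (L + 1))
    blocks : E +² I ≡ weightSum blockWeight (upTo L) (map carlitz⁻¹ cs)
    blocks = begin
      E +² I
        ≡⟨ cong₂ _+²_ (trans (weightSum-mapᵢ _ suc (upTo L) _) (weightSum-map _ proj₁ (upTo L) cs))
                      (trans (weightSum-mapᵢ _ suc (upTo L) _) (weightSum-map _ (reverse ∘ proj₂) (upTo L) cs)) ⟩
      weightSum (λ n → eulerMahonianWeight (suc n) ∘ proj₁) (upTo L) cs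
        +² weightSum (λ n → inverseWeight (suc n) ∘ reverse ∘ proj₂) (upTo L) cs
        ≡⟨ weightSum-+² _ _ (upTo L) cs ⟩
      weightSum (λ n c → eulerMahonianWeight (suc n) (proj₁ c) +² inverseWeight (suc n) (reverse (proj₂ c))) (upTo L) cs
        ≡⟨ weightSum-cong (upTo L) (λ n {c} → termWeight-block n {c}) valid ⟩
      weightSum (λ n c → blockWeight n (carlitz⁻¹ c)) (upTo L) cs
        ≡⟨ weightSum-map blockWeight carlitz⁻¹ (upTo L) cs ⟨
      weightSum blockWeight (upTo L) (map carlitz⁻¹ cs) ∎

theorem1p2 : (d M : ℕ) → 1 ≤ d → 1 ≤ M → (p q : ℕ) → sigma d M p q ≡ rhs d M p q
theorem1p2 d M 1≤d _ = Enumeration-unique diamonds terms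
  where
  open Carlitz d
  open BlockDecomposition d
  open RightHandSide d M
  diamonds : Enumeration (sigma d M) (Stack M ValidWord) (λ (m , cs) → diamondWeight (m , map carlitz⁻¹ cs))
  diamonds = Enumeration-transport
    (Enumeration-transport (Enumeration-sigma d M) (diamond-correspondence 1≤d M) λ _ → refl)
    (Correspondence-Stack M carlitz-correspondence) λ _ → refl
  terms : Enumeration (rhs d M) (Stack M ValidWord) (λ (m , cs) → diamondWeight (m , map carlitz⁻¹ cs))
  terms = Enumeration-transport Enumeration-rhs term-correspondence termWeight≡diamondWeight
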